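{- For every integer $p\ge1$, as formal power series, $$(v\delta_1-1)H^{(p)}(t,u,v,z)=(v-1)tz+t\big(z(v-1)-v\big)H^{(p)}(t,u,1,z)+tuv^{p+1}H^{(p)}(t,uv,1,z),$$ where $\delta_1=1+t(u-1)$.
   Context: For a finite integer sequence $(a_1,\dots,a_i)$, $\mathrm{asc}(a_1,\dots,a_i)=|\{j:1\le j<i,\ a_j<a_{j+1}\}|$. For an integer $p\ge1$, a $p$-ascent sequence of length $n\ge1$ is a sequence $(a_1,\dots,a_n)$ of nonnegative integers with $a_1=0$ and $a_i\le p+\mathrm{asc}(a_1,\dots,a_{i-1})$ for all $2\le i\le n$. $H^{(p)}(t,u,v,z)=\sum_w t^{|w|}u^{\mathrm{asc}(w)}v^{\mathrm{last}(w)}z^{|w|_0}$, summed over all nonempty $p$-ascent sequences $w$, where $|w|$ is the length, $\mathrm{last}(w)$ the last letter and $|w|_0$ the number of zeros of $w$. -}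

module Defs where

open import Data.Nat using (ℕ; zero; suc; _+_; _∸_; _<ᵇ_; _≤ᵇ_; _≡ᵇ_)
open import Data.Bool using (Bool; true; false; _∧_; if_then_else_)
open import Data.List using (List; []; _∷_; length; filter; take; map; concatMap; upTo)
open import Data.Bool.ListAction using (and)
open import Data.Integer using (ℤ; +_; -_) renaming (_+_ to _+ℤ_; _*_ to _*ℤ_)
open import Data.Product using (_×_; _,_)
open import Relation.Nullary.Decidable using (Dec; yes; no)
open import Data.Bool.Properties using () renaming (_≟_ to _≟B_)
open import Relation.Binary.PropositionalEquality using (_≡_)

-- Sequences are lists of naturals (a₁,…,aₙ), indexed from 0 in Agda.

asc : List ℕ → ℕ
asc []           = 0
asc (x ∷ [])     = 0
asc (x ∷ y ∷ xs) = (if x <ᵇ y then 1 else 0) + asc (y ∷ xs)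

-- last letter (only used on nonempty lists; default 0 for [])
lastL : List ℕ → ℕ
lastL []           = 0
lastL (x ∷ [])     = x
lastL (x ∷ y ∷ xs) = lastL (y ∷ xs)

zeros : List ℕ → ℕ
zeros []       = 0
zeros (x ∷ xs) = (if x ≡ᵇ 0 then 1 else 0) + zeros xs

nth : ℕ → List ℕ → ℕ
nth _       []       = 0
nth zero    (x ∷ xs) = x
nth (suc i) (x ∷ xs) = nth i xs

-- p-ascent sequence: nonempty, a₁ = 0, and for 2 ≤ i ≤ n,
-- aᵢ ≤ p + asc(a₁,…,a_{i-1}).  With 0-based index k = i-1 ∈ [1, n-1]:
-- w[k] ≤ p + asc (take k w).
isPAscent : ℕ → List ℕ → Bool
isPAscent p []       = false
isPAscent p (x ∷ xs) =
  (x ≡ᵇ 0) ∧ and (map (λ k → nth (suc k) (x ∷ xs) ≤ᵇ p + asc (take (suc k) (x ∷ xs)))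
                      (upTo (length xs)))

allLists : ℕ → ℕ → List (List ℕ)
allLists m zero    = [] ∷ []
allLists m (suc n) = concatMap (λ x → map (x ∷_) (allLists m n)) (upTo m)

-- p-ascent sequences of length n. Every entry of a p-ascent sequence of
-- length n is ≤ p + (n-1) < p + n, so candidates with entries < p + n suffice.
pAscentSeqs : ℕ → ℕ → List (List ℕ)
pAscentSeqs p n = filter (λ w → (isPAscent p w) ≟B true) (allLists (p + n) n)

-- Formal power series in t,u,v,z with integer coefficients:
-- coefficient of t^n u^a v^b z^c.

Series : Set
Series = ℕ → ℕ → ℕ → ℕ → ℤ

_≈ₛ_ : Series → Series → Set
f ≈ₛ g = ∀ n a b c → f n a b c ≡ g n a b c

infix 4 _≈ₛ_
infixl 6 _⊕_ _⊖_
infixl 7 _⊛_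

_⊕_ : Series → Series → Series
(f ⊕ g) n a b c = f n a b c +ℤ g n a b c

⊝_ : Series → Series
(⊝ f) n a b c = - f n a b c

_⊖_ : Series → Series → Series
f ⊖ g = f ⊕ (⊝ g)

sumTo : (ℕ → ℤ) → ℕ → ℤ
sumTo f zero    = f 0
sumTo f (suc n) = sumTo f n +ℤ f (suc n)

_⊛_ : Series → Series → Series
(f ⊛ g) n a b c =
  sumTo (λ i → sumTo (λ j → sumTo (λ k → sumTo (λ l →
     f i j k l *ℤ g (n ∸ i) (a ∸ j) (b ∸ k) (c ∸ l)) c) b) a) n

mono : ℕ → ℕ → ℕ → ℕ → Series
mono i j k l n a b c =
  if (i ≡ᵇ n) ∧ (j ≡ᵇ a) ∧ (k ≡ᵇ b) ∧ (l ≡ᵇ c) then + 1 else + 0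

𝟙 tS uS vS zS : Series
𝟙  = mono 0 0 0 0
tS = mono 1 0 0 0
uS = mono 0 1 0 0
vS = mono 0 0 1 0
zS = mono 0 0 0 1

vPow : ℕ → Series
vPow m = mono 0 0 m 0

-- Generating series  Σ_w t^{|w|} u^{e₁(w)} v^{e₂(w)} z^{e₃(w)}
-- over nonempty p-ascent sequences w, for an exponent map e.
genSeries : ℕ → (List ℕ → ℕ × ℕ × ℕ) → Series
genSeries p e n a b c =
  + length (filter (λ w → matches (e w) ≟B true)
                   (pAscentSeqs p n))
  where
  matches : ℕ × ℕ × ℕ → Bool
  matches (x , y , r) = (x ≡ᵇ a) ∧ (y ≡ᵇ b) ∧ (r ≡ᵇ c)

-- H^{(p)}(t,u,v,z) = Σ_w t^{|w|} u^{asc w} v^{last w} z^{|w|₀}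
H : ℕ → Series
H p = genSeries p (λ w → asc w , lastL w , zeros w)

-- H^{(p)}(t,u,1,z)
H-v1 : ℕ → Series
H-v1 p = genSeries p (λ w → asc w , 0 , zeros w)

-- H^{(p)}(t,uv,1,z) : (uv)^{asc w} = u^{asc w} v^{asc w}
H-uv1 : ℕ → Series
H-uv1 p = genSeries p (λ w → asc w , asc w , zeros w)

δ₁ : Series
δ₁ = 𝟙 ⊕ tS ⊛ (uS ⊖ 𝟙)

-- Every p-ascent sequence of length n + 2 is uniquely w x with w a p-ascent sequence of length
-- n + 1 and x ≤ K = p + asc w; appending x adds [last w < x] ascents and [x = 0] zeros. So the
-- coefficient of tⁿ⁺² in H(t,u,v,z) is Σ_w U_w (z + Σ_{1≤x≤l} vˣ + u Σ_{l<x≤K} vˣ), where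
-- U_w = u^{asc w} z^{|w|₀} and l = last w. Multiplying by v − 1 telescopes both geometric sums into
-- U_w (z (v − 1) − v + u v^{K+1} − (u − 1) v^{l+1}), and summed over w these are the coefficients of
-- tⁿ⁺¹ in (z (v − 1) − v) H(t,u,1,z), u v^{p+1} H(t,uv,1,z) and −(u − 1) v H(t,u,v,z). As
-- v δ₁ − 1 = (v − 1) + t v (u − 1), this is the identity at tⁿ⁺²; at t⁰ and t¹ it is checked directly.

module Submission where

open import Defs
open import Data.Nat using (ℕ; zero; suc; _+_; _*_; _∸_; _≤_; _<_; _≥_; z≤n; s≤s; z<s; _≡ᵇ_; _<ᵇ_; _≤ᵇ_)
open import Data.Nat.Properties
open import Data.Nat.Tactic.RingSolver using (solve-∀)
open import Data.Bool using (Bool; true; false; T; _∧_; if_then_else_)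
open import Data.Bool.Properties using (∧-assoc; ∧-identityʳ; ∧-conicalˡ; ∧-conicalʳ; ∧-commutativeMonoid)
  renaming (_≟_ to _≟B_)
open import Data.Bool.ListAction using (and)
open import Data.List using (List; []; _∷_; _++_; _∷ʳ_; length; filter; take; map; concatMap; upTo)
open import Data.List.Properties using (upTo-∷ʳ; map-++; length-++; take-all)
open import Data.List.Reverse using (Reverse; reverseView; []; _∶_∶ʳ_)
open import Data.List.Relation.Unary.All using (All; []; _∷_)
import Data.List.Relation.Unary.All as All
open import Data.List.Relation.Unary.All.Properties using (∷ʳ⁺)
open import Data.Integer as ℤ using (ℤ; -_) renaming (_+_ to _+ℤ_; _*_ to _*ℤ_)
import Data.Integer.Properties as ℤP
import Data.Integer.Tactic.RingSolver as ℤ-Solver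
open import Data.Product using (_,_)
open import Data.Empty using (⊥-elim)
open import Relation.Nullary using (¬_; Dec)
open import Relation.Nullary.Decidable using (dec-true; dec-false)
open import Relation.Binary.Bundles using (Setoid)
open import Relation.Binary.Definitions using (tri<; tri≈; tri>)
open import Relation.Binary.PropositionalEquality
open import Algebra.Bundles using (CommutativeMonoid; AbelianGroup)
open import Algebra.Properties.CommutativeSemigroup +-commutativeSemigroup using (interchange; x∙yz≈y∙xz)
open import Algebra.Properties.CommutativeSemigroup *-commutativeSemigroup using () renaming (x∙yz≈y∙xz to x*yz≡y*xz)
open import Algebra.Properties.CommutativeSemigroup ℤP.+-commutativeSemigroup using ()
  renaming (interchange to +ℤ-interchange)
open import Algebra.Properties.CommutativeSemigroup (CommutativeMonoid.commutativeSemigroup ∧-commutativeMonoid)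
  using () renaming (interchange to ∧-interchange)
open import Algebra.Properties.Group (AbelianGroup.group ℤP.+-0-abelianGroup) using (∙-cancelʳ)
import Relation.Binary.Reasoning.Setoid as SetoidReasoning
open ≡-Reasoning

⟦_⟧ : Bool → ℕ
⟦ b ⟧ = if b then 1 else 0

⟦∧⟧ : ∀ a b → ⟦ a ∧ b ⟧ ≡ ⟦ a ⟧ * ⟦ b ⟧
⟦∧⟧ true  b = sym (+-identityʳ ⟦ b ⟧)
⟦∧⟧ false b = refl

-- does (m ≟ n), does (m <? n) and does (m ≤? n) reduce to m ≡ᵇ n, m <ᵇ n and m ≤ᵇ n.
≡ᵇ-refl : ∀ n → (n ≡ᵇ n) ≡ true
≡ᵇ-refl n = dec-true (n ≟ n) refl

≢⇒≡ᵇ≡false : ∀ {m n} → m ≢ n → (m ≡ᵇ n) ≡ false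
≢⇒≡ᵇ≡false {m} {n} = dec-false (m ≟ n)

<⇒<ᵇ≡true : ∀ {m n} → m < n → (m <ᵇ n) ≡ true
<⇒<ᵇ≡true {m} {n} = dec-true (m <? n)

≮⇒<ᵇ≡false : ∀ {m n} → ¬ m < n → (m <ᵇ n) ≡ false
≮⇒<ᵇ≡false {m} {n} = dec-false (m <? n)

≤⇒≤ᵇ≡true : ∀ {m n} → m ≤ n → (m ≤ᵇ n) ≡ true
≤⇒≤ᵇ≡true {m} {n} = dec-true (m ≤? n)

≰⇒≤ᵇ≡false : ∀ {m n} → ¬ m ≤ n → (m ≤ᵇ n) ≡ false
≰⇒≤ᵇ≡false {m} {n} = dec-false (m ≤? n)

⟦<ᵇ⟧-split : ∀ m n → ⟦ m <ᵇ n ⟧ ≡ ⟦ n ≡ᵇ suc m ⟧ + ⟦ suc m <ᵇ n ⟧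
⟦<ᵇ⟧-split m       zero          = refl
⟦<ᵇ⟧-split zero    (suc zero)    = refl
⟦<ᵇ⟧-split zero    (suc (suc n)) = refl
⟦<ᵇ⟧-split (suc m) (suc n)       = ⟦<ᵇ⟧-split m n

≤ᵇ-∧-∸-≡ᵇ : ∀ i j n → (i ≤ᵇ n) ∧ (j ≡ᵇ n ∸ i) ≡ (i + j ≡ᵇ n)
≤ᵇ-∧-∸-≡ᵇ zero          j n       = refl
≤ᵇ-∧-∸-≡ᵇ (suc i)       j zero    = refl
≤ᵇ-∧-∸-≡ᵇ (suc zero)    j (suc n) = ≤ᵇ-∧-∸-≡ᵇ zero j n
≤ᵇ-∧-∸-≡ᵇ (suc (suc i)) j (suc n) = ≤ᵇ-∧-∸-≡ᵇ (suc i) j n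

∧-transpose : ∀ a b c d a′ b′ c′ d′ →
  (a ∧ b ∧ c ∧ d) ∧ (a′ ∧ b′ ∧ c′ ∧ d′) ≡ (a ∧ a′) ∧ (b ∧ b′) ∧ (c ∧ c′) ∧ (d ∧ d′)
∧-transpose a b c d a′ b′ c′ d′ =
  trans (∧-interchange a (b ∧ c ∧ d) a′ (b′ ∧ c′ ∧ d′)) (cong ((a ∧ a′) ∧_)
  (trans (∧-interchange b (c ∧ d) b′ (c′ ∧ d′)) (cong ((b ∧ b′) ∧_) (∧-interchange c d c′ d′))))

sum< : ℕ → (ℕ → ℕ) → ℕ
sum< zero    g = 0
sum< (suc n) g = sum< n g + g n

sum<-cong : ∀ n {g h : ℕ → ℕ} → (∀ x → x < n → g x ≡ h x) → sum< n g ≡ sum< n h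
sum<-cong zero    eq = refl
sum<-cong (suc n) eq = cong₂ _+_ (sum<-cong n (λ x x<n → eq x (m<n⇒m<1+n x<n))) (eq n ≤-refl)

sum<-*ˡ : ∀ n k (g : ℕ → ℕ) → sum< n (λ x → k * g x) ≡ k * sum< n g
sum<-*ˡ zero    k g = sym (*-zeroʳ k)
sum<-*ˡ (suc n) k g = trans (cong (_+ k * g n) (sum<-*ˡ n k g)) (sym (*-distribˡ-+ k _ _))

sum<-vanishing-tail : ∀ n d (g : ℕ → ℕ) → (∀ x → n ≤ x → g x ≡ 0) → sum< (d + n) g ≡ sum< n g
sum<-vanishing-tail n zero    g tail = refl
sum<-vanishing-tail n (suc d) g tail = begin
  sum< (d + n) g + g (d + n) ≡⟨ cong₂ _+_ (sum<-vanishing-tail n d g tail) (tail (d + n) (m≤n+m n d)) ⟩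
  sum< n g + 0               ≡⟨ +-identityʳ _ ⟩
  sum< n g                   ∎

sum<-δ : ∀ n b (g : ℕ → ℕ) → sum< n (λ x → ⟦ x ≡ᵇ b ⟧ * g x) ≡ ⟦ b <ᵇ n ⟧ * g b
sum<-δ zero    b g = refl
sum<-δ (suc n) b g with <-cmp b n
... | tri< b<n _ _ = begin
  sum< n (λ x → ⟦ x ≡ᵇ b ⟧ * g x) + ⟦ n ≡ᵇ b ⟧ * g n
    ≡⟨ cong₂ _+_ (sum<-δ n b g) (cong (λ t → ⟦ t ⟧ * g n) (≢⇒≡ᵇ≡false (>⇒≢ b<n))) ⟩
  ⟦ b <ᵇ n ⟧ * g b + 0
    ≡⟨ +-identityʳ _ ⟩
  ⟦ b <ᵇ n ⟧ * g b
    ≡⟨ cong (λ t → ⟦ t ⟧ * g b) (trans (<⇒<ᵇ≡true b<n) (sym (<⇒<ᵇ≡true (m<n⇒m<1+n b<n)))) ⟩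
  ⟦ b <ᵇ suc n ⟧ * g b ∎
... | tri≈ _ refl _ = begin
  sum< b (λ x → ⟦ x ≡ᵇ b ⟧ * g x) + ⟦ b ≡ᵇ b ⟧ * g b
    ≡⟨ cong₂ _+_ (sum<-δ b b g) (cong (λ t → ⟦ t ⟧ * g b) (≡ᵇ-refl b)) ⟩
  ⟦ b <ᵇ b ⟧ * g b + 1 * g b
    ≡⟨ cong (λ t → ⟦ t ⟧ * g b + 1 * g b) (≮⇒<ᵇ≡false (n≮n b)) ⟩
  1 * g b
    ≡⟨ cong (λ t → ⟦ t ⟧ * g b) (sym (<⇒<ᵇ≡true (n<1+n b))) ⟩
  ⟦ b <ᵇ suc b ⟧ * g b ∎
... | tri> _ _ n<b = begin
  sum< n (λ x → ⟦ x ≡ᵇ b ⟧ * g x) + ⟦ n ≡ᵇ b ⟧ * g n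
    ≡⟨ cong₂ _+_ (sum<-δ n b g) (cong (λ t → ⟦ t ⟧ * g n) (≢⇒≡ᵇ≡false (<⇒≢ n<b))) ⟩
  ⟦ b <ᵇ n ⟧ * g b + 0
    ≡⟨ cong (λ t → ⟦ t ⟧ * g b + 0) (≮⇒<ᵇ≡false (<⇒≯ n<b)) ⟩
  0
    ≡⟨ cong (λ t → ⟦ t ⟧ * g b) (sym (≮⇒<ᵇ≡false (λ b<1+n → <⇒≱ n<b (≤-pred b<1+n)))) ⟩
  ⟦ b <ᵇ suc n ⟧ * g b ∎

sum<-restrict : ∀ K M (g : ℕ → ℕ) → K < M → sum< M (λ y → ⟦ y ≤ᵇ K ⟧ * g y) ≡ sum< (suc K) g
sum<-restrict K M g K<M = begin
  sum< M (λ y → ⟦ y ≤ᵇ K ⟧ * g y)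
    ≡⟨ cong (λ n → sum< n _) (sym (m∸n+n≡m K<M)) ⟩
  sum< (M ∸ suc K + suc K) (λ y → ⟦ y ≤ᵇ K ⟧ * g y)
    ≡⟨ sum<-vanishing-tail (suc K) (M ∸ suc K) _ (λ y K<y → cong (λ b → ⟦ b ⟧ * g y) (≰⇒≤ᵇ≡false (<⇒≱ K<y))) ⟩
  sum< (suc K) (λ y → ⟦ y ≤ᵇ K ⟧ * g y)
    ≡⟨ sum<-cong (suc K) (λ y y<1+K →
         trans (cong (λ b → ⟦ b ⟧ * g y) (≤⇒≤ᵇ≡true (≤-pred y<1+K))) (+-identityʳ (g y))) ⟩
  sum< (suc K) g ∎

sumOver : {A : Set} → List A → (A → ℕ) → ℕ
sumOver []       f = 0
sumOver (x ∷ xs) f = f x + sumOver xs f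

module _ {A : Set} where

  sumOver-cong : ∀ (xs : List A) {f g : A → ℕ} → (∀ x → f x ≡ g x) → sumOver xs f ≡ sumOver xs g
  sumOver-cong []       eq = refl
  sumOver-cong (x ∷ xs) eq = cong₂ _+_ (eq x) (sumOver-cong xs eq)

  sumOver-++ : ∀ (xs ys : List A) f → sumOver (xs ++ ys) f ≡ sumOver xs f + sumOver ys f
  sumOver-++ []       ys f = refl
  sumOver-++ (x ∷ xs) ys f = trans (cong (f x +_) (sumOver-++ xs ys f)) (sym (+-assoc (f x) _ _))

  sumOver-+ : ∀ (xs : List A) f g → sumOver xs (λ x → f x + g x) ≡ sumOver xs f + sumOver xs g
  sumOver-+ []       f g = refl
  sumOver-+ (x ∷ xs) f g = trans (cong (f x + g x +_) (sumOver-+ xs f g)) (interchange (f x) (g x) _ _)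

  sumOver-zero : ∀ (xs : List A) → sumOver xs (λ _ → 0) ≡ 0
  sumOver-zero []       = refl
  sumOver-zero (x ∷ xs) = sumOver-zero xs

  length≡sumOver : ∀ (xs : List A) → length xs ≡ sumOver xs (λ _ → 1)
  length≡sumOver []       = refl
  length≡sumOver (x ∷ xs) = cong suc (length≡sumOver xs)

  sumOver-filter : ∀ (b : A → Bool) xs f →
    sumOver (filter (λ x → b x ≟B true) xs) f ≡ sumOver xs (λ x → ⟦ b x ⟧ * f x)
  sumOver-filter b []       f = refl
  sumOver-filter b (x ∷ xs) f with b x
  ... | true  = cong₂ _+_ (sym (+-identityʳ (f x))) (sumOver-filter b xs f)
  ... | false = sumOver-filter b xs f

module _ {A B : Set} where

  sumOver-map : ∀ (g : A → B) xs f → sumOver (map g xs) f ≡ sumOver xs (λ x → f (g x))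
  sumOver-map g []       f = refl
  sumOver-map g (x ∷ xs) f = cong (f (g x) +_) (sumOver-map g xs f)

  sumOver-concatMap : ∀ (g : A → List B) xs f → sumOver (concatMap g xs) f ≡ sumOver xs (λ x → sumOver (g x) f)
  sumOver-concatMap g []       f = refl
  sumOver-concatMap g (x ∷ xs) f =
    trans (sumOver-++ (g x) (concatMap g xs) f) (cong (sumOver (g x) f +_) (sumOver-concatMap g xs f))

sumOver-upTo : ∀ n g → sumOver (upTo n) g ≡ sum< n g
sumOver-upTo zero    g = refl
sumOver-upTo (suc n) g = begin
  sumOver (upTo (suc n)) g     ≡⟨ cong (λ xs → sumOver xs g) (sym (upTo-∷ʳ n)) ⟩
  sumOver (upTo n ∷ʳ n) g      ≡⟨ sumOver-++ (upTo n) (n ∷ []) g ⟩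
  sumOver (upTo n) g + (g n + 0) ≡⟨ cong₂ _+_ (sumOver-upTo n g) (+-identityʳ (g n)) ⟩
  sum< n g + g n               ∎

sumOver-allLists-suc : ∀ m n f →
  sumOver (allLists m (suc n)) f ≡ sum< m (λ x → sumOver (allLists m n) (λ w → f (x ∷ w)))
sumOver-allLists-suc m n f = begin
  sumOver (concatMap (λ x → map (x ∷_) (allLists m n)) (upTo m)) f
    ≡⟨ sumOver-concatMap (λ x → map (x ∷_) (allLists m n)) (upTo m) f ⟩
  sumOver (upTo m) (λ x → sumOver (map (x ∷_) (allLists m n)) f)
    ≡⟨ sumOver-cong (upTo m) (λ x → sumOver-map (x ∷_) (allLists m n) f) ⟩
  sumOver (upTo m) (λ x → sumOver (allLists m n) (λ w → f (x ∷ w)))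
    ≡⟨ sumOver-upTo m _ ⟩
  sum< m (λ x → sumOver (allLists m n) (λ w → f (x ∷ w))) ∎

sumOver-allLists-cong : ∀ m n {f g : List ℕ → ℕ} → (∀ w → length w ≡ n → f w ≡ g w) →
  sumOver (allLists m n) f ≡ sumOver (allLists m n) g
sumOver-allLists-cong m zero    eq = cong (_+ 0) (eq [] refl)
sumOver-allLists-cong m (suc n) {f} {g} eq = begin
  sumOver (allLists m (suc n)) f
    ≡⟨ sumOver-allLists-suc m n f ⟩
  sum< m (λ x → sumOver (allLists m n) (λ w → f (x ∷ w)))
    ≡⟨ sum<-cong m (λ x _ → sumOver-allLists-cong m n (λ w ∣w∣ → eq (x ∷ w) (cong suc ∣w∣))) ⟩
  sum< m (λ x → sumOver (allLists m n) (λ w → g (x ∷ w)))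
    ≡⟨ sumOver-allLists-suc m n g ⟨
  sumOver (allLists m (suc n)) g ∎

sumOver-allLists-∷ʳ : ∀ m n f →
  sumOver (allLists m (suc n)) f ≡ sumOver (allLists m n) (λ w → sum< m (λ y → f (w ∷ʳ y)))
sumOver-allLists-∷ʳ m zero    f =
  trans (sumOver-allLists-suc m 0 f) (trans (sum<-cong m (λ x _ → +-identityʳ _)) (sym (+-identityʳ _)))
sumOver-allLists-∷ʳ m (suc n) f = begin
  sumOver (allLists m (suc (suc n))) f
    ≡⟨ sumOver-allLists-suc m (suc n) f ⟩
  sum< m (λ x → sumOver (allLists m (suc n)) (λ w → f (x ∷ w)))
    ≡⟨ sum<-cong m (λ x _ → sumOver-allLists-∷ʳ m n (λ w → f (x ∷ w))) ⟩
  sum< m (λ x → sumOver (allLists m n) (λ w → sum< m (λ y → f (x ∷ w ∷ʳ y))))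
    ≡⟨ sumOver-allLists-suc m n (λ w → sum< m (λ y → f (w ∷ʳ y))) ⟨
  sumOver (allLists m (suc n)) (λ w → sum< m (λ y → f (w ∷ʳ y))) ∎

sumOver-allLists-widen : ∀ m d n (f : List ℕ → ℕ) →
  (∀ w → length w ≡ n → ¬ All (_< m) w → f w ≡ 0) →
  sumOver (allLists (d + m) n) f ≡ sumOver (allLists m n) f
sumOver-allLists-widen m d zero    f vanish = refl
sumOver-allLists-widen m d (suc n) f vanish = begin
  sumOver (allLists (d + m) (suc n)) f
    ≡⟨ sumOver-allLists-suc (d + m) n f ⟩
  sum< (d + m) (λ x → sumOver (allLists (d + m) n) (λ w → f (x ∷ w)))
    ≡⟨ sum<-vanishing-tail m d _ large-head ⟩
  sum< m (λ x → sumOver (allLists (d + m) n) (λ w → f (x ∷ w)))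
    ≡⟨ sum<-cong m (λ x x<m → sumOver-allLists-widen m d n (λ w → f (x ∷ w))
                     (λ w ∣w∣ ¬all → vanish (x ∷ w) (cong suc ∣w∣) (λ { (_ ∷ all) → ¬all all }))) ⟩
  sum< m (λ x → sumOver (allLists m n) (λ w → f (x ∷ w)))
    ≡⟨ sumOver-allLists-suc m n f ⟨
  sumOver (allLists m (suc n)) f ∎
  where
  large-head : ∀ x → m ≤ x → sumOver (allLists (d + m) n) (λ w → f (x ∷ w)) ≡ 0
  large-head x m≤x = trans
    (sumOver-allLists-cong (d + m) n (λ w ∣w∣ → vanish (x ∷ w) (cong suc ∣w∣) (λ { (x<m ∷ _) → <⇒≱ x<m m≤x })))
    (sumOver-zero (allLists (d + m) n))

asc-∷ʳ : ∀ x xs y → asc ((x ∷ xs) ∷ʳ y) ≡ ⟦ lastL (x ∷ xs) <ᵇ y ⟧ + asc (x ∷ xs)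
asc-∷ʳ x []       y = refl
asc-∷ʳ x (z ∷ zs) y =
  trans (cong (⟦ x <ᵇ z ⟧ +_) (asc-∷ʳ z zs y)) (x∙yz≈y∙xz ⟦ x <ᵇ z ⟧ _ (asc (z ∷ zs)))

lastL-∷ʳ : ∀ xs y → lastL (xs ∷ʳ y) ≡ y
lastL-∷ʳ []           y = refl
lastL-∷ʳ (x ∷ [])     y = refl
lastL-∷ʳ (x ∷ z ∷ zs) y = lastL-∷ʳ (z ∷ zs) y

zeros-∷ʳ : ∀ xs y → zeros (xs ∷ʳ y) ≡ ⟦ y ≡ᵇ 0 ⟧ + zeros xs
zeros-∷ʳ []       y = refl
zeros-∷ʳ (x ∷ xs) y =
  trans (cong (⟦ x ≡ᵇ 0 ⟧ +_) (zeros-∷ʳ xs y)) (x∙yz≈y∙xz ⟦ x ≡ᵇ 0 ⟧ _ (zeros xs))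

asc≤length : ∀ x xs → asc (x ∷ xs) ≤ length xs
asc≤length x []       = z≤n
asc≤length x (z ∷ zs) with x <ᵇ z
... | true  = s≤s (asc≤length z zs)
... | false = m≤n⇒m≤1+n (asc≤length z zs)

length-∷ʳ : ∀ (xs : List ℕ) y → length (xs ∷ʳ y) ≡ suc (length xs)
length-∷ʳ xs y = trans (length-++ xs) (+-comm (length xs) 1)

nth-++ˡ : ∀ k (xs ys : List ℕ) → k < length xs → nth k (xs ++ ys) ≡ nth k xs
nth-++ˡ zero    (x ∷ xs) ys _         = refl
nth-++ˡ (suc k) (x ∷ xs) ys (s≤s k<n) = nth-++ˡ k xs ys k<n

nth-length-∷ʳ : ∀ (xs : List ℕ) y → nth (length xs) (xs ∷ʳ y) ≡ y
nth-length-∷ʳ []       y = refl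
nth-length-∷ʳ (x ∷ xs) y = nth-length-∷ʳ xs y

take-++ˡ : ∀ k (xs ys : List ℕ) → k ≤ length xs → take k (xs ++ ys) ≡ take k xs
take-++ˡ zero    xs       ys _         = refl
take-++ˡ (suc k) (x ∷ xs) ys (s≤s k≤n) = cong (x ∷_) (take-++ˡ k xs ys k≤n)

andUpTo : ℕ → (ℕ → Bool) → Bool
andUpTo zero    F = true
andUpTo (suc n) F = andUpTo n F ∧ F n

and-map-upTo : ∀ n F → and (map F (upTo n)) ≡ andUpTo n F
and-map-upTo zero    F = refl
and-map-upTo (suc n) F = begin
  and (map F (upTo (suc n)))             ≡⟨ cong (λ xs → and (map F xs)) (sym (upTo-∷ʳ n)) ⟩
  and (map F (upTo n ∷ʳ n))             ≡⟨ cong and (map-++ F (upTo n) (n ∷ [])) ⟩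
  and (map F (upTo n) ++ F n ∷ [])        ≡⟨ and-∷ʳ (map F (upTo n)) ⟩
  and (map F (upTo n)) ∧ F n             ≡⟨ cong (_∧ F n) (and-map-upTo n F) ⟩
  andUpTo n F ∧ F n                      ∎
  where
  and-∷ʳ : ∀ bs → and (bs ∷ʳ F n) ≡ and bs ∧ F n
  and-∷ʳ []       = ∧-identityʳ (F n)
  and-∷ʳ (b ∷ bs) = trans (cong (b ∧_) (and-∷ʳ bs)) (sym (∧-assoc b (and bs) (F n)))

andUpTo-cong : ∀ n {F G : ℕ → Bool} → (∀ k → k < n → F k ≡ G k) → andUpTo n F ≡ andUpTo n G
andUpTo-cong zero    eq = refl
andUpTo-cong (suc n) eq = cong₂ _∧_ (andUpTo-cong n (λ k k<n → eq k (m<n⇒m<1+n k<n))) (eq n ≤-refl)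

isPAscent-∷ʳ : ∀ p x xs y →
  isPAscent p ((x ∷ xs) ∷ʳ y) ≡ isPAscent p (x ∷ xs) ∧ (y ≤ᵇ p + asc (x ∷ xs))
isPAscent-∷ʳ p x xs y = begin
  (x ≡ᵇ 0) ∧ and (map rule′ (upTo (length (xs ∷ʳ y))))
    ≡⟨ cong (λ n → (x ≡ᵇ 0) ∧ and (map rule′ (upTo n))) (length-∷ʳ xs y) ⟩
  (x ≡ᵇ 0) ∧ and (map rule′ (upTo (suc n)))
    ≡⟨ cong ((x ≡ᵇ 0) ∧_) (and-map-upTo (suc n) rule′) ⟩
  (x ≡ᵇ 0) ∧ (andUpTo n rule′ ∧ rule′ n)
    ≡⟨ cong₂ (λ b b′ → (x ≡ᵇ 0) ∧ (b ∧ b′)) (andUpTo-cong n earlier) last ⟩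
  (x ≡ᵇ 0) ∧ (andUpTo n rule ∧ (y ≤ᵇ p + asc (x ∷ xs)))
    ≡⟨ ∧-assoc (x ≡ᵇ 0) _ _ ⟨
  ((x ≡ᵇ 0) ∧ andUpTo n rule) ∧ (y ≤ᵇ p + asc (x ∷ xs))
    ≡⟨ cong (λ b → ((x ≡ᵇ 0) ∧ b) ∧ (y ≤ᵇ p + asc (x ∷ xs))) (and-map-upTo n rule) ⟨
  isPAscent p (x ∷ xs) ∧ (y ≤ᵇ p + asc (x ∷ xs)) ∎
  where
  n : ℕ
  n = length xs
  rule rule′ : ℕ → Bool
  rule  k = nth (suc k) (x ∷ xs) ≤ᵇ p + asc (take (suc k) (x ∷ xs))
  rule′ k = nth (suc k) (x ∷ xs ∷ʳ y) ≤ᵇ p + asc (take (suc k) (x ∷ xs ∷ʳ y))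
  earlier : ∀ k → k < n → rule′ k ≡ rule k
  earlier k k<n = cong₂ (λ a t → a ≤ᵇ p + asc (x ∷ t))
    (nth-++ˡ k xs (y ∷ []) k<n) (take-++ˡ k xs (y ∷ []) (<⇒≤ k<n))
  last : rule′ n ≡ (y ≤ᵇ p + asc (x ∷ xs))
  last = cong₂ (λ a t → a ≤ᵇ p + asc (x ∷ t))
    (nth-length-∷ʳ xs y) (trans (take-++ˡ n xs (y ∷ []) ≤-refl) (take-all n xs ≤-refl))

pAscent-letters-bounded : ∀ p w → isPAscent p w ≡ true → All (_≤ p + asc w) w
pAscent-letters-bounded p w = go w (reverseView w)
  where
  go : ∀ w → Reverse w → isPAscent p w ≡ true → All (_≤ p + asc w) w
  go .[] [] ()
  go .(zero ∷ []) ([] ∶ _ ∶ʳ zero) _ = z≤n ∷ []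
  go .(suc y ∷ []) ([] ∶ _ ∶ʳ suc y) ()
  go .((x ∷ xs) ∷ʳ y) ((x ∷ xs) ∶ rs ∶ʳ y) pa = ∷ʳ⁺ (All.map (λ le → ≤-trans le grows) (go (x ∷ xs) rs pa-w))
                                                 (≤-trans (≤ᵇ⇒≤ y _ (subst T (sym y-ok) _)) grows)
    where
    split : isPAscent p (x ∷ xs) ∧ (y ≤ᵇ p + asc (x ∷ xs)) ≡ true
    split = trans (sym (isPAscent-∷ʳ p x xs y)) pa
    pa-w : isPAscent p (x ∷ xs) ≡ true
    pa-w = ∧-conicalˡ _ _ split
    y-ok : (y ≤ᵇ p + asc (x ∷ xs)) ≡ true
    y-ok = ∧-conicalʳ _ _ split
    grows : p + asc (x ∷ xs) ≤ p + asc ((x ∷ xs) ∷ʳ y)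
    grows = +-monoʳ-≤ p (subst (asc (x ∷ xs) ≤_) (sym (asc-∷ʳ x xs y)) (m≤n+m _ _))

All-lastL : ∀ {P : ℕ → Set} x xs → All P (x ∷ xs) → P (lastL (x ∷ xs))
All-lastL x []       (px ∷ []) = px
All-lastL x (z ∷ zs) (_ ∷ pzs) = All-lastL z zs pzs

-- δ³ x y z a b c is the coefficient of uᵃ vᵇ zᶜ in uˣ vʸ zᶻ.
uzCoeff : ℕ → ℕ → ℕ → ℕ → ℕ
uzCoeff a c x z = ⟦ x ≡ᵇ a ⟧ * ⟦ z ≡ᵇ c ⟧

δ³ : ℕ → ℕ → ℕ → ℕ → ℕ → ℕ → ℕ
δ³ x y z a b c = ⟦ y ≡ᵇ b ⟧ * uzCoeff a c x z

⟦≡ᵇ³⟧≡δ³ : ∀ x y z a b c → ⟦ (x ≡ᵇ a) ∧ (y ≡ᵇ b) ∧ (z ≡ᵇ c) ⟧ ≡ δ³ x y z a b c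
⟦≡ᵇ³⟧≡δ³ x y z a b c = begin
  ⟦ (x ≡ᵇ a) ∧ (y ≡ᵇ b) ∧ (z ≡ᵇ c) ⟧         ≡⟨ ⟦∧⟧ (x ≡ᵇ a) _ ⟩
  ⟦ x ≡ᵇ a ⟧ * ⟦ (y ≡ᵇ b) ∧ (z ≡ᵇ c) ⟧       ≡⟨ cong (⟦ x ≡ᵇ a ⟧ *_) (⟦∧⟧ (y ≡ᵇ b) (z ≡ᵇ c)) ⟩
  ⟦ x ≡ᵇ a ⟧ * (⟦ y ≡ᵇ b ⟧ * ⟦ z ≡ᵇ c ⟧)     ≡⟨ x*yz≡y*xz ⟦ x ≡ᵇ a ⟧ ⟦ y ≡ᵇ b ⟧ _ ⟩
  δ³ x y z a b c                            ∎

⟦≤ᵇ³⟧*δ³ : ∀ j k l x y z a b c →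
  ⟦ (j ≤ᵇ a) ∧ (k ≤ᵇ b) ∧ (l ≤ᵇ c) ⟧ * δ³ x y z (a ∸ j) (b ∸ k) (c ∸ l) ≡ δ³ (j + x) (k + y) (l + z) a b c
⟦≤ᵇ³⟧*δ³ j k l x y z a b c = begin
  ⟦ Gᵤ ∧ Gᵥ ∧ G_z ⟧ * (⟦ Dᵥ ⟧ * (⟦ Dᵤ ⟧ * ⟦ D_z ⟧))
    ≡⟨ cong (_* (⟦ Dᵥ ⟧ * (⟦ Dᵤ ⟧ * ⟦ D_z ⟧))) (trans (⟦∧⟧ Gᵤ _) (cong (⟦ Gᵤ ⟧ *_) (⟦∧⟧ Gᵥ G_z))) ⟩
  ⟦ Gᵤ ⟧ * (⟦ Gᵥ ⟧ * ⟦ G_z ⟧) * (⟦ Dᵥ ⟧ * (⟦ Dᵤ ⟧ * ⟦ D_z ⟧))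
    ≡⟨ pair-up ⟦ Gᵤ ⟧ ⟦ Gᵥ ⟧ ⟦ G_z ⟧ ⟦ Dᵤ ⟧ ⟦ Dᵥ ⟧ ⟦ D_z ⟧ ⟩
  ⟦ Gᵥ ⟧ * ⟦ Dᵥ ⟧ * (⟦ Gᵤ ⟧ * ⟦ Dᵤ ⟧ * (⟦ G_z ⟧ * ⟦ D_z ⟧))
    ≡⟨ cong₂ (λ v uz → v * uz) (sym (⟦∧⟧ Gᵥ Dᵥ)) (cong₂ _*_ (sym (⟦∧⟧ Gᵤ Dᵤ)) (sym (⟦∧⟧ G_z D_z))) ⟩
  ⟦ Gᵥ ∧ Dᵥ ⟧ * (⟦ Gᵤ ∧ Dᵤ ⟧ * ⟦ G_z ∧ D_z ⟧)
    ≡⟨ cong₂ (λ v uz → ⟦ v ⟧ * uz) (≤ᵇ-∧-∸-≡ᵇ k y b)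
         (cong₂ (λ u z → ⟦ u ⟧ * ⟦ z ⟧) (≤ᵇ-∧-∸-≡ᵇ j x a) (≤ᵇ-∧-∸-≡ᵇ l z c)) ⟩
  δ³ (j + x) (k + y) (l + z) a b c ∎
  where
  Gᵤ Gᵥ G_z Dᵤ Dᵥ D_z : Bool
  Gᵤ = j ≤ᵇ a
  Gᵥ = k ≤ᵇ b
  G_z = l ≤ᵇ c
  Dᵤ = x ≡ᵇ a ∸ j
  Dᵥ = y ≡ᵇ b ∸ k
  D_z = z ≡ᵇ c ∸ l
  pair-up : ∀ gᵤ gᵥ g_z dᵤ dᵥ d_z →
    gᵤ * (gᵥ * g_z) * (dᵥ * (dᵤ * d_z)) ≡ gᵥ * dᵥ * (gᵤ * dᵤ * (g_z * d_z))
  pair-up = solve-∀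

sumPAscent : ℕ → ℕ → (List ℕ → ℕ) → ℕ
sumPAscent p n f = sumOver (allLists (p + n) n) (λ w → ⟦ isPAscent p w ⟧ * f w)

module _ (p n : ℕ) where

  sumPAscent-cong : ∀ {f g} → (∀ w → isPAscent p w ≡ true → length w ≡ n → f w ≡ g w) →
    sumPAscent p n f ≡ sumPAscent p n g
  sumPAscent-cong {f} {g} eq = sumOver-allLists-cong (p + n) n pointwise
    where
    pointwise : ∀ w → length w ≡ n → ⟦ isPAscent p w ⟧ * f w ≡ ⟦ isPAscent p w ⟧ * g w
    pointwise w ∣w∣ with isPAscent p w in pa
    ... | true  = cong (_+ 0) (eq w pa ∣w∣)
    ... | false = refl

  sumPAscent-+ : ∀ f g → sumPAscent p n (λ w → f w + g w) ≡ sumPAscent p n f + sumPAscent p n g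
  sumPAscent-+ f g = trans
    (sumOver-cong (allLists (p + n) n) (λ w → *-distribˡ-+ ⟦ isPAscent p w ⟧ (f w) (g w)))
    (sumOver-+ (allLists (p + n) n) _ _)

  sumPAscent-+⁴ : ∀ f g h k →
    sumPAscent p n (λ w → f w + g w + h w + k w) ≡ sumPAscent p n f + sumPAscent p n g + sumPAscent p n h + sumPAscent p n k
  sumPAscent-+⁴ f g h k =
    trans (sumPAscent-+ (λ w → f w + g w + h w) k) (cong (_+ sumPAscent p n k)
    (trans (sumPAscent-+ (λ w → f w + g w) h) (cong (_+ sumPAscent p n h) (sumPAscent-+ f g))))

  sumPAscent-zero : ∀ f → (∀ w → f w ≡ 0) → sumPAscent p n f ≡ 0
  sumPAscent-zero f f≡0 = trans
    (sumOver-cong (allLists (p + n) n) (λ w → trans (cong (⟦ isPAscent p w ⟧ *_) (f≡0 w)) (*-zeroʳ ⟦ isPAscent p w ⟧)))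
    (sumOver-zero (allLists (p + n) n))

  genSeries≡sumPAscent : ∀ (e₁ e₂ e₃ : List ℕ → ℕ) a b c →
    genSeries p (λ w → e₁ w , e₂ w , e₃ w) n a b c ≡ ℤ.+ sumPAscent p n (λ w → δ³ (e₁ w) (e₂ w) (e₃ w) a b c)
  genSeries≡sumPAscent e₁ e₂ e₃ a b c = cong ℤ.+_ (begin
    length (filter matches? (filter pa? all))
      ≡⟨ length≡sumOver (filter matches? (filter pa? all)) ⟩
    sumOver (filter matches? (filter pa? all)) (λ _ → 1)
      ≡⟨ sumOver-filter matches (filter pa? all) (λ _ → 1) ⟩
    sumOver (filter pa? all) (λ w → ⟦ matches w ⟧ * 1)
      ≡⟨ sumOver-filter (isPAscent p) all _ ⟩
    sumOver all (λ w → ⟦ isPAscent p w ⟧ * (⟦ matches w ⟧ * 1))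
      ≡⟨ sumOver-cong all (λ w → cong (⟦ isPAscent p w ⟧ *_)
           (trans (*-identityʳ _) (⟦≡ᵇ³⟧≡δ³ (e₁ w) (e₂ w) (e₃ w) a b c))) ⟩
    sumPAscent p n (λ w → δ³ (e₁ w) (e₂ w) (e₃ w) a b c) ∎)
    where
    all : List (List ℕ)
    all = allLists (p + n) n
    matches : List ℕ → Bool
    matches w = (e₁ w ≡ᵇ a) ∧ (e₂ w ≡ᵇ b) ∧ (e₃ w ≡ᵇ c)
    matches? : ∀ w → Dec (matches w ≡ true)
    pa? : ∀ w → Dec (isPAscent p w ≡ true)
    matches? w = matches w ≟B true
    pa? w = isPAscent p w ≟B true

sumPAscent-singleton : ∀ p f → sumPAscent p 1 f ≡ f (0 ∷ [])
sumPAscent-singleton p f = begin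
  sumOver (allLists (p + 1) 1) (λ w → ⟦ isPAscent p w ⟧ * f w)
    ≡⟨ sumOver-allLists-suc (p + 1) 0 _ ⟩
  sum< (p + 1) (λ x → ⟦ (x ≡ᵇ 0) ∧ true ⟧ * f (x ∷ []) + 0)
    ≡⟨ sum<-cong (p + 1) (λ x _ → trans (+-identityʳ _) (cong (λ b → ⟦ b ⟧ * f (x ∷ [])) (∧-identityʳ (x ≡ᵇ 0)))) ⟩
  sum< (p + 1) (λ x → ⟦ x ≡ᵇ 0 ⟧ * f (x ∷ []))
    ≡⟨ sum<-δ (p + 1) 0 (λ x → f (x ∷ [])) ⟩
  ⟦ 0 <ᵇ p + 1 ⟧ * f (0 ∷ [])
    ≡⟨ cong (λ b → ⟦ b ⟧ * f (0 ∷ [])) (<⇒<ᵇ≡true (subst (0 <_) (+-comm 1 p) z<s)) ⟩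
  f (0 ∷ []) + 0
    ≡⟨ +-identityʳ _ ⟩
  f (0 ∷ []) ∎

sumPAscent-∷ʳ : ∀ p m f →
  sumPAscent p (suc (suc m)) f ≡ sumPAscent p (suc m) (λ w → sum< (suc (p + asc w)) (λ y → f (w ∷ʳ y)))
sumPAscent-∷ʳ p m f = begin
  sumOver (allLists M (suc (suc m))) (λ w → ⟦ isPAscent p w ⟧ * f w)
    ≡⟨ sumOver-allLists-∷ʳ M (suc m) _ ⟩
  sumOver (allLists M (suc m)) (λ w → sum< M (λ y → ⟦ isPAscent p (w ∷ʳ y) ⟧ * f (w ∷ʳ y)))
    ≡⟨ sumOver-allLists-cong M (suc m) admissible-letters ⟩
  sumOver (allLists M (suc m)) G
    ≡⟨ cong (λ n → sumOver (allLists n (suc m)) G) (+-suc p (suc m)) ⟩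
  sumOver (allLists (1 + (p + suc m)) (suc m)) G
    ≡⟨ sumOver-allLists-widen (p + suc m) 1 (suc m) G out-of-range ⟩
  sumPAscent p (suc m) (λ w → sum< (suc (p + asc w)) (λ y → f (w ∷ʳ y))) ∎
  where
  M : ℕ
  M = p + suc (suc m)
  G : List ℕ → ℕ
  G w = ⟦ isPAscent p w ⟧ * sum< (suc (p + asc w)) (λ y → f (w ∷ʳ y))
  admissible-letters : ∀ w → length w ≡ suc m → sum< M (λ y → ⟦ isPAscent p (w ∷ʳ y) ⟧ * f (w ∷ʳ y)) ≡ G w
  admissible-letters (x ∷ xs) ∣w∣ = begin
    sum< M (λ y → ⟦ isPAscent p (w ∷ʳ y) ⟧ * f (w ∷ʳ y))
      ≡⟨ sum<-cong M (λ y _ → trans (cong (λ b → ⟦ b ⟧ * f (w ∷ʳ y)) (isPAscent-∷ʳ p x xs y))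
                             (trans (cong (_* f (w ∷ʳ y)) (⟦∧⟧ (isPAscent p w) _)) (*-assoc ⟦ isPAscent p w ⟧ _ _))) ⟩
    sum< M (λ y → ⟦ isPAscent p w ⟧ * (⟦ y ≤ᵇ K ⟧ * f (w ∷ʳ y)))
      ≡⟨ sum<-*ˡ M ⟦ isPAscent p w ⟧ _ ⟩
    ⟦ isPAscent p w ⟧ * sum< M (λ y → ⟦ y ≤ᵇ K ⟧ * f (w ∷ʳ y))
      ≡⟨ cong (⟦ isPAscent p w ⟧ *_) (sum<-restrict K M _ K<M) ⟩
    G w ∎
    where
    w : List ℕ
    w = x ∷ xs
    K : ℕ
    K = p + asc w
    K<M : K < M
    K<M = +-monoʳ-< p (s≤s (≤-trans (asc≤length x xs) (≤-trans (≤-reflexive (suc-injective ∣w∣)) (n≤1+n m))))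
  out-of-range : ∀ w → length w ≡ suc m → ¬ All (_< p + suc m) w → G w ≡ 0
  out-of-range (x ∷ xs) ∣w∣ ¬bounded with isPAscent p (x ∷ xs) in pa
  ... | false = refl
  ... | true  = ⊥-elim (¬bounded (All.map (λ le → ≤-<-trans le (+-monoʳ-< p asc<1+m))
                                          (pAscent-letters-bounded p (x ∷ xs) pa)))
    where
    asc<1+m : asc (x ∷ xs) < suc m
    asc<1+m = s≤s (≤-trans (asc≤length x xs) (≤-reflexive (suc-injective ∣w∣)))

-- The coefficient of vᵇ in Σ_{x ≤ K} u^{s + [l < x]} vˣ z^{y + [x = 0]}, with uᵉ zᶠ weighted by φ e f:
-- the monomials of the children w x of a p-ascent w with s ascents, last letter l and y zeros,
-- where K = p + s.
childrenCoeff : (ℕ → ℕ → ℕ) → ℕ → ℕ → ℕ → ℕ → ℕ → ℕ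
childrenCoeff φ K s l y b = ⟦ b <ᵇ suc K ⟧ * φ (⟦ l <ᵇ b ⟧ + s) (⟦ b ≡ᵇ 0 ⟧ + y)

H-by-last-letter : ∀ p m a b c →
  H p (suc (suc m)) a b c ≡ ℤ.+ sumPAscent p (suc m) (λ w → childrenCoeff (uzCoeff a c) (p + asc w) (asc w) (lastL w) (zeros w) b)
H-by-last-letter p m a b c = trans (genSeries≡sumPAscent p (suc (suc m)) asc lastL zeros a b c) (cong ℤ.+_ (begin
  sumPAscent p (suc (suc m)) (λ w → δ³ (asc w) (lastL w) (zeros w) a b c)
    ≡⟨ sumPAscent-∷ʳ p m _ ⟩
  sumPAscent p (suc m) (λ w → sum< (suc (p + asc w)) (λ x → δ³ (asc (w ∷ʳ x)) (lastL (w ∷ʳ x)) (zeros (w ∷ʳ x)) a b c))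
    ≡⟨ sumPAscent-cong p (suc m) (λ w _ ∣w∣ → append-one w ∣w∣) ⟩
  sumPAscent p (suc m) (λ w → childrenCoeff (uzCoeff a c) (p + asc w) (asc w) (lastL w) (zeros w) b) ∎))
  where
  append-one : ∀ w → length w ≡ suc m →
    sum< (suc (p + asc w)) (λ x → δ³ (asc (w ∷ʳ x)) (lastL (w ∷ʳ x)) (zeros (w ∷ʳ x)) a b c)
      ≡ childrenCoeff (uzCoeff a c) (p + asc w) (asc w) (lastL w) (zeros w) b
  append-one (v ∷ vs) _ = trans (sum<-cong (suc (p + asc w)) (λ x _ → letter x)) (sum<-δ (suc (p + asc w)) b _)
    where
    w : List ℕ
    w = v ∷ vs
    letter : ∀ x → δ³ (asc (w ∷ʳ x)) (lastL (w ∷ʳ x)) (zeros (w ∷ʳ x)) a b c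
                 ≡ ⟦ x ≡ᵇ b ⟧ * uzCoeff a c (⟦ lastL w <ᵇ x ⟧ + asc w) (⟦ x ≡ᵇ 0 ⟧ + zeros w)
    letter x rewrite asc-∷ʳ v vs x | lastL-∷ʳ w x | zeros-∷ʳ w x = refl

v·_ : (ℕ → ℕ) → ℕ → ℕ
(v· g) zero    = 0
(v· g) (suc b) = g b

module _ (φ : ℕ → ℕ → ℕ) (s y : ℕ) where

  private
    P₀ P₁ Q : ℕ
    P₀ = φ s y
    P₁ = φ (suc s) y
    Q  = φ s (suc y)

  -- Multiplied by v − 1 the children polynomial telescopes: only x = 0, the jump of the
  -- u-exponent at x = l + 1, and x = K + 1 survive.
  children-recurrence : ∀ K l → l ≤ K → ∀ b →
      (v· childrenCoeff φ K s l y) b + ⟦ suc l ≡ᵇ b ⟧ * P₁ + ⟦ 0 ≡ᵇ b ⟧ * Q + ⟦ 1 ≡ᵇ b ⟧ * P₀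
    ≡ ⟦ 1 ≡ᵇ b ⟧ * Q + ⟦ suc K ≡ᵇ b ⟧ * P₁ + ⟦ suc l ≡ᵇ b ⟧ * P₀ + childrenCoeff φ K s l y b
  children-recurrence K       l       _   zero          = +-identityʳ _
  children-recurrence zero    zero    _   (suc zero)    = x+y+0+z≡x+y+z+0 (Q + 0) (P₁ + 0) (P₀ + 0)
    where
    x+y+0+z≡x+y+z+0 : ∀ x y z → x + y + 0 + z ≡ x + y + z + 0
    x+y+0+z≡x+y+z+0 = solve-∀
  children-recurrence (suc K) zero    _   (suc zero)    = x+y+0+z≡x+0+z+y (Q + 0) (P₁ + 0) (P₀ + 0)
    where
    x+y+0+z≡x+0+z+y : ∀ x y z → x + y + 0 + z ≡ x + 0 + z + y
    x+y+0+z≡x+0+z+y = solve-∀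
  children-recurrence (suc K) (suc l) _   (suc zero)    = refl
  children-recurrence K       l       l≤K (suc (suc B)) with <-cmp l (suc B)
  ... | tri< l<β l≢β _ rewrite <⇒<ᵇ≡true l<β | ≢⇒≡ᵇ≡false l≢β | <⇒<ᵇ≡true (m<n⇒m<1+n l<β) = begin
    ⟦ B <ᵇ K ⟧ * P₁ + 0 + 0 + 0
      ≡⟨ cong (λ n → n * P₁ + 0 + 0 + 0) (⟦<ᵇ⟧-split B K) ⟩
    (⟦ K ≡ᵇ suc B ⟧ + ⟦ suc B <ᵇ K ⟧) * P₁ + 0 + 0 + 0
      ≡⟨ [e+g]x+0+0+0≡ex+0+gx ⟦ K ≡ᵇ suc B ⟧ ⟦ suc B <ᵇ K ⟧ P₁ ⟩
    ⟦ K ≡ᵇ suc B ⟧ * P₁ + 0 + ⟦ suc B <ᵇ K ⟧ * P₁ ∎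
    where
    [e+g]x+0+0+0≡ex+0+gx : ∀ e g x → (e + g) * x + 0 + 0 + 0 ≡ e * x + 0 + g * x
    [e+g]x+0+0+0≡ex+0+gx = solve-∀
  ... | tri≈ _ refl _ rewrite ≮⇒<ᵇ≡false (n≮n B) | ≡ᵇ-refl B | <⇒<ᵇ≡true (n<1+n B) | <⇒<ᵇ≡true l≤K = begin
    P₀ + 0 + (P₁ + 0) + 0 + 0
      ≡⟨ x+0+[z+0]+0+0≡1z+[x+0] P₀ P₁ ⟩
    1 * P₁ + (P₀ + 0)
      ≡⟨ cong (λ n → n * P₁ + (P₀ + 0)) K≡β∨β<K ⟩
    (⟦ K ≡ᵇ suc B ⟧ + ⟦ suc B <ᵇ K ⟧) * P₁ + (P₀ + 0)
      ≡⟨ [e+g]z+x≡ez+x+gz ⟦ K ≡ᵇ suc B ⟧ ⟦ suc B <ᵇ K ⟧ P₁ (P₀ + 0) ⟩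
    ⟦ K ≡ᵇ suc B ⟧ * P₁ + (P₀ + 0) + ⟦ suc B <ᵇ K ⟧ * P₁ ∎
    where
    K≡β∨β<K : 1 ≡ ⟦ K ≡ᵇ suc B ⟧ + ⟦ suc B <ᵇ K ⟧
    K≡β∨β<K = trans (cong ⟦_⟧ (sym (<⇒<ᵇ≡true l≤K))) (⟦<ᵇ⟧-split B K)
    x+0+[z+0]+0+0≡1z+[x+0] : ∀ x z → x + 0 + (z + 0) + 0 + 0 ≡ 1 * z + (x + 0)
    x+0+[z+0]+0+0≡1z+[x+0] = solve-∀
    [e+g]z+x≡ez+x+gz : ∀ e g z x → (e + g) * z + x ≡ e * z + x + g * z
    [e+g]z+x≡ez+x+gz = solve-∀
  ... | tri> _ l≢β β<l rewrite ≮⇒<ᵇ≡false (≤⇒≯ (<⇒≤ β<l)) | ≢⇒≡ᵇ≡false l≢β | ≮⇒<ᵇ≡false (≤⇒≯ β<l)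
                             | <⇒<ᵇ≡true (<-trans (n<1+n B) (<-≤-trans β<l l≤K)) | ≢⇒≡ᵇ≡false (>⇒≢ (<-≤-trans β<l l≤K))
                             | <⇒<ᵇ≡true (<-≤-trans β<l l≤K) = x+0+0+0≡x (P₀ + 0)
    where
    x+0+0+0≡x : ∀ x → x + 0 + 0 + 0 ≡ x
    x+0+0+0≡x = solve-∀

when : Bool → ℤ → ℤ
when c x = if c then x else ℤ.+ 0

when-∧ : ∀ c d x → when (c ∧ d) x ≡ when c (when d x)
when-∧ true  d x = refl
when-∧ false d x = refl

when-+ : ∀ c x y → when c (x +ℤ y) ≡ when c x +ℤ when c y
when-+ true  x y = refl
when-+ false x y = refl

when-neg : ∀ c x → when c (- x) ≡ - when c x
when-neg true  x = refl
when-neg false x = refl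

when-1* : ∀ c x → when c (ℤ.+ 1) *ℤ x ≡ when c x
when-1* true  x = ℤP.*-identityˡ x
when-1* false x = refl

when-1 : ∀ c → when c (ℤ.+ 1) ≡ ℤ.+ ⟦ c ⟧
when-1 true  = refl
when-1 false = refl

shift : ℕ → ℕ → ℕ → ℕ → Series → Series
shift i j k l f n a b c =
  when ((i ≤ᵇ n) ∧ (j ≤ᵇ a) ∧ (k ≤ᵇ b) ∧ (l ≤ᵇ c)) (f (n ∸ i) (a ∸ j) (b ∸ k) (c ∸ l))

sumTo-cong : ∀ {f g : ℕ → ℤ} n → (∀ i → f i ≡ g i) → sumTo f n ≡ sumTo g n
sumTo-cong zero    eq = eq 0
sumTo-cong (suc n) eq = cong₂ _+ℤ_ (sumTo-cong n eq) (eq (suc n))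

sumTo-+ : ∀ (f g : ℕ → ℤ) n → sumTo (λ i → f i +ℤ g i) n ≡ sumTo f n +ℤ sumTo g n
sumTo-+ f g zero    = refl
sumTo-+ f g (suc n) = trans (cong (_+ℤ (f (suc n) +ℤ g (suc n))) (sumTo-+ f g n)) (+ℤ-interchange (sumTo f n) (sumTo g n) (f (suc n)) (g (suc n)))

sumTo-neg : ∀ (f : ℕ → ℤ) n → sumTo (λ i → - f i) n ≡ - sumTo f n
sumTo-neg f zero    = refl
sumTo-neg f (suc n) = trans (cong (_+ℤ - f (suc n)) (sumTo-neg f n)) (sym (ℤP.neg-distrib-+ (sumTo f n) (f (suc n))))

sumTo-when : ∀ c (f : ℕ → ℤ) n → sumTo (λ i → when c (f i)) n ≡ when c (sumTo f n)
sumTo-when true  f n = refl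
sumTo-when false f zero    = refl
sumTo-when false f (suc n) = trans (ℤP.+-identityʳ _) (sumTo-when false f n)

sumTo-when-cong : ∀ c n {f : ℕ → ℤ} {r} → sumTo f n ≡ r → sumTo (λ i → when c (f i)) n ≡ when c r
sumTo-when-cong c n {f} eq = trans (sumTo-when c f n) (cong (when c) eq)

sumTo-δ : ∀ i (g : ℕ → ℤ) n → sumTo (λ x → when (i ≡ᵇ x) (g x)) n ≡ when (i ≤ᵇ n) (g i)
sumTo-δ zero    g zero    = refl
sumTo-δ (suc i) g zero    = refl
sumTo-δ i       g (suc n) with <-cmp i (suc n)
... | tri< i<1+n i≢1+n _ rewrite sumTo-δ i g n | ≤⇒≤ᵇ≡true (≤-pred i<1+n) | ≢⇒≡ᵇ≡false i≢1+n
                                | ≤⇒≤ᵇ≡true (<⇒≤ i<1+n) = ℤP.+-identityʳ (g i)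
... | tri≈ _ refl _ rewrite sumTo-δ (suc n) g n | ≰⇒≤ᵇ≡false (<⇒≱ (s≤s (≤-refl {n}))) | ≡ᵇ-refl n
                          | ≤⇒≤ᵇ≡true (≤-refl {suc n}) = ℤP.+-identityˡ (g (suc n))
... | tri> _ i≢1+n 1+n<i rewrite sumTo-δ i g n | ≰⇒≤ᵇ≡false (<⇒≱ (<⇒≤ 1+n<i)) | ≢⇒≡ᵇ≡false i≢1+n
                                | ≰⇒≤ᵇ≡false (<⇒≱ 1+n<i) = refl

Σ⁴ : (ℕ → ℕ → ℕ → ℕ → ℤ) → Series
Σ⁴ F n a b c = sumTo (λ i → sumTo (λ j → sumTo (λ k → sumTo (λ l → F i j k l) c) b) a) n

Σ⁴-cong : ∀ {F G} → (∀ i j k l → F i j k l ≡ G i j k l) → Σ⁴ F ≈ₛ Σ⁴ G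
Σ⁴-cong eq n a b c = sumTo-cong n λ i → sumTo-cong a λ j → sumTo-cong b λ k → sumTo-cong c λ l → eq i j k l

Σ⁴-+ : ∀ F G → Σ⁴ (λ i j k l → F i j k l +ℤ G i j k l) ≈ₛ Σ⁴ F ⊕ Σ⁴ G
Σ⁴-+ F G n a b c =
  trans (sumTo-cong n λ i → trans (sumTo-cong a λ j → trans (sumTo-cong b λ k → sumTo-+ _ _ c)
                                                           (sumTo-+ _ _ b))
                                  (sumTo-+ _ _ a))
        (sumTo-+ _ _ n)

Σ⁴-neg : ∀ F → Σ⁴ (λ i j k l → - F i j k l) ≈ₛ ⊝ Σ⁴ F
Σ⁴-neg F n a b c =
  trans (sumTo-cong n λ i → trans (sumTo-cong a λ j → trans (sumTo-cong b λ k → sumTo-neg _ c)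
                                                           (sumTo-neg _ b))
                                  (sumTo-neg _ a))
        (sumTo-neg _ n)

≈ₛ-refl : ∀ {f} → f ≈ₛ f
≈ₛ-refl n a b c = refl

≈ₛ-setoid : Setoid _ _
≈ₛ-setoid = record
  { Carrier       = Series
  ; _≈_           = _≈ₛ_
  ; isEquivalence = record
    { refl  = ≈ₛ-refl
    ; sym   = λ f≈g n a b c → sym (f≈g n a b c)
    ; trans = λ f≈g g≈h n a b c → trans (f≈g n a b c) (g≈h n a b c)
    }
  }

open SetoidReasoning ≈ₛ-setoid using (step-≈-⟩; step-≈-⟨) renaming (begin_ to begin≈_; _∎ to _∎≈)

⊕-cong : ∀ {f f′ g g′} → f ≈ₛ f′ → g ≈ₛ g′ → f ⊕ g ≈ₛ f′ ⊕ g′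
⊕-cong f≈f′ g≈g′ n a b c = cong₂ _+ℤ_ (f≈f′ n a b c) (g≈g′ n a b c)

⊖-cong : ∀ {f f′ g g′} → f ≈ₛ f′ → g ≈ₛ g′ → f ⊖ g ≈ₛ f′ ⊖ g′
⊖-cong f≈f′ g≈g′ n a b c = cong₂ _+ℤ_ (f≈f′ n a b c) (cong -_ (g≈g′ n a b c))

⊛-congˡ : ∀ {f f′} g → f ≈ₛ f′ → f ⊛ g ≈ₛ f′ ⊛ g
⊛-congˡ g f≈f′ n a b c = Σ⁴-cong (λ i j k l → cong (_*ℤ g (n ∸ i) (a ∸ j) (b ∸ k) (c ∸ l)) (f≈f′ i j k l)) n a b c

⊛-distribʳ-⊕ : ∀ f g h → (f ⊕ g) ⊛ h ≈ₛ f ⊛ h ⊕ g ⊛ h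
⊛-distribʳ-⊕ f g h n a b c =
  trans (Σ⁴-cong (λ i j k l → ℤP.*-distribʳ-+ (h (n ∸ i) (a ∸ j) (b ∸ k) (c ∸ l)) (f i j k l) (g i j k l)) n a b c)
        (Σ⁴-+ _ _ n a b c)

⊛-distribʳ-⊖ : ∀ f g h → (f ⊖ g) ⊛ h ≈ₛ f ⊛ h ⊖ g ⊛ h
⊛-distribʳ-⊖ f g h n a b c = trans (⊛-distribʳ-⊕ f (⊝ g) h n a b c) (cong ((f ⊛ h) n a b c +ℤ_) negated)
  where
  negated : ((⊝ g) ⊛ h) n a b c ≡ - (g ⊛ h) n a b c
  negated = trans (Σ⁴-cong (λ i j k l → sym (ℤP.neg-distribˡ-* (g i j k l) (h (n ∸ i) (a ∸ j) (b ∸ k) (c ∸ l)))) n a b c)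
                  (Σ⁴-neg _ n a b c)

module _ (i j k l : ℕ) where

  private
    inRange : ℕ → ℕ → ℕ → ℕ → Bool
    inRange n a b c = (i ≤ᵇ n) ∧ (j ≤ᵇ a) ∧ (k ≤ᵇ b) ∧ (l ≤ᵇ c)

  shift-cong : ∀ {f g} → f ≈ₛ g → shift i j k l f ≈ₛ shift i j k l g
  shift-cong f≈g n a b c = cong (when (inRange n a b c)) (f≈g (n ∸ i) (a ∸ j) (b ∸ k) (c ∸ l))

  shift-⊕ : ∀ f g → shift i j k l (f ⊕ g) ≈ₛ shift i j k l f ⊕ shift i j k l g
  shift-⊕ f g n a b c = when-+ (inRange n a b c) _ _

  shift-⊖ : ∀ f g → shift i j k l (f ⊖ g) ≈ₛ shift i j k l f ⊖ shift i j k l g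
  shift-⊖ f g n a b c = trans (when-+ (inRange n a b c) _ _) (cong (shift i j k l f n a b c +ℤ_) (when-neg (inRange n a b c) _))

  mono-⊛ : ∀ f → mono i j k l ⊛ f ≈ₛ shift i j k l f
  mono-⊛ f n a b c = begin
    Σ⁴ (λ x y z w → mono i j k l x y z w *ℤ F x y z w) n a b c
      ≡⟨ Σ⁴-cong (λ x y z w → trans (when-1* ((i ≡ᵇ x) ∧ (j ≡ᵇ y) ∧ (k ≡ᵇ z) ∧ (l ≡ᵇ w)) (F x y z w))
                                     (nested (i ≡ᵇ x) (j ≡ᵇ y) (k ≡ᵇ z) (l ≡ᵇ w))) n a b c ⟩
    Σ⁴ (λ x y z w → when (i ≡ᵇ x) (when (j ≡ᵇ y) (when (k ≡ᵇ z) (when (l ≡ᵇ w) (F x y z w))))) n a b c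
      ≡⟨ sumTo-cong n (λ x → sumTo-cong a λ y → sumTo-cong b λ z →
           sumTo-when-cong (i ≡ᵇ x) c (sumTo-when-cong (j ≡ᵇ y) c (sumTo-when-cong (k ≡ᵇ z) c (sumTo-δ l (F x y z) c)))) ⟩
    sumTo (λ x → sumTo (λ y → sumTo (λ z →
      when (i ≡ᵇ x) (when (j ≡ᵇ y) (when (k ≡ᵇ z) (when (l ≤ᵇ c) (F x y z l))))) b) a) n
      ≡⟨ sumTo-cong n (λ x → sumTo-cong a λ y →
           sumTo-when-cong (i ≡ᵇ x) b (sumTo-when-cong (j ≡ᵇ y) b (sumTo-δ k (λ z → when (l ≤ᵇ c) (F x y z l)) b))) ⟩
    sumTo (λ x → sumTo (λ y → when (i ≡ᵇ x) (when (j ≡ᵇ y) (when (k ≤ᵇ b) (when (l ≤ᵇ c) (F x y k l))))) a) n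
      ≡⟨ sumTo-cong n (λ x → sumTo-when-cong (i ≡ᵇ x) a (sumTo-δ j (λ y → when (k ≤ᵇ b) (when (l ≤ᵇ c) (F x y k l))) a)) ⟩
    sumTo (λ x → when (i ≡ᵇ x) (when (j ≤ᵇ a) (when (k ≤ᵇ b) (when (l ≤ᵇ c) (F x j k l))))) n
      ≡⟨ sumTo-δ i (λ x → when (j ≤ᵇ a) (when (k ≤ᵇ b) (when (l ≤ᵇ c) (F x j k l)))) n ⟩
    when (i ≤ᵇ n) (when (j ≤ᵇ a) (when (k ≤ᵇ b) (when (l ≤ᵇ c) (F i j k l))))
      ≡⟨ nested (i ≤ᵇ n) (j ≤ᵇ a) (k ≤ᵇ b) (l ≤ᵇ c) ⟨
    shift i j k l f n a b c ∎
    where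
    F : ℕ → ℕ → ℕ → ℕ → ℤ
    F x y z w = f (n ∸ x) (a ∸ y) (b ∸ z) (c ∸ w)
    nested : ∀ {x} c₁ c₂ c₃ c₄ → when (c₁ ∧ c₂ ∧ c₃ ∧ c₄) x ≡ when c₁ (when c₂ (when c₃ (when c₄ x)))
    nested c₁ c₂ c₃ c₄ = trans (when-∧ c₁ _ _) (cong (when c₁) (trans (when-∧ c₂ _ _) (cong (when c₂) (when-∧ c₃ c₄ _))))

shift-mono : ∀ i j k l i′ j′ k′ l′ →
  shift i j k l (mono i′ j′ k′ l′) ≈ₛ mono (i + i′) (j + j′) (k + k′) (l + l′)
shift-mono i j k l i′ j′ k′ l′ n a b c = begin
  when inRange (when atShiftedPoint (ℤ.+ 1))             ≡⟨ when-∧ inRange atShiftedPoint (ℤ.+ 1) ⟨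
  when (inRange ∧ atShiftedPoint) (ℤ.+ 1)                ≡⟨ cong (λ d → when d (ℤ.+ 1)) coordinatewise ⟩
  mono (i + i′) (j + j′) (k + k′) (l + l′) n a b c ∎
  where
  inRange atShiftedPoint : Bool
  inRange        = (i ≤ᵇ n) ∧ (j ≤ᵇ a) ∧ (k ≤ᵇ b) ∧ (l ≤ᵇ c)
  atShiftedPoint = (i′ ≡ᵇ n ∸ i) ∧ (j′ ≡ᵇ a ∸ j) ∧ (k′ ≡ᵇ b ∸ k) ∧ (l′ ≡ᵇ c ∸ l)
  coordinatewise : inRange ∧ atShiftedPoint ≡ (i + i′ ≡ᵇ n) ∧ (j + j′ ≡ᵇ a) ∧ (k + k′ ≡ᵇ b) ∧ (l + l′ ≡ᵇ c)
  coordinatewise = trans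
    (∧-transpose (i ≤ᵇ n) (j ≤ᵇ a) (k ≤ᵇ b) (l ≤ᵇ c) (i′ ≡ᵇ n ∸ i) (j′ ≡ᵇ a ∸ j) (k′ ≡ᵇ b ∸ k) (l′ ≡ᵇ c ∸ l))
    (cong₂ _∧_ (≤ᵇ-∧-∸-≡ᵇ i i′ n)
    (cong₂ _∧_ (≤ᵇ-∧-∸-≡ᵇ j j′ a)
    (cong₂ _∧_ (≤ᵇ-∧-∸-≡ᵇ k k′ b) (≤ᵇ-∧-∸-≡ᵇ l l′ c))))

mono-⊛-mono : ∀ i j k l i′ j′ k′ l′ →
  mono i j k l ⊛ mono i′ j′ k′ l′ ≈ₛ mono (i + i′) (j + j′) (k + k′) (l + l′)
mono-⊛-mono i j k l i′ j′ k′ l′ n a b c =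
  trans (mono-⊛ i j k l (mono i′ j′ k′ l′) n a b c) (shift-mono i j k l i′ j′ k′ l′ n a b c)

vδ₁⊖𝟙-expansion : vS ⊛ δ₁ ⊖ 𝟙 ≈ₛ mono 0 0 1 0 ⊕ (mono 1 1 1 0 ⊖ mono 1 0 1 0) ⊖ 𝟙
vδ₁⊖𝟙-expansion = ⊖-cong (begin≈
  vS ⊛ (𝟙 ⊕ tS ⊛ (uS ⊖ 𝟙))
    ≈⟨ mono-⊛ 0 0 1 0 (𝟙 ⊕ tS ⊛ (uS ⊖ 𝟙)) ⟩
  shift 0 0 1 0 (𝟙 ⊕ tS ⊛ (uS ⊖ 𝟙))
    ≈⟨ shift-⊕ 0 0 1 0 𝟙 (tS ⊛ (uS ⊖ 𝟙)) ⟩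
  shift 0 0 1 0 𝟙 ⊕ shift 0 0 1 0 (tS ⊛ (uS ⊖ 𝟙))
    ≈⟨ ⊕-cong (shift-mono 0 0 1 0 0 0 0 0) (shift-cong 0 0 1 0 t[u-1]≈) ⟩
  mono 0 0 1 0 ⊕ shift 0 0 1 0 (mono 1 1 0 0 ⊖ mono 1 0 0 0)
    ≈⟨ ⊕-cong (≈ₛ-refl {mono 0 0 1 0}) (shift-⊖ 0 0 1 0 (mono 1 1 0 0) (mono 1 0 0 0)) ⟩
  mono 0 0 1 0 ⊕ (shift 0 0 1 0 (mono 1 1 0 0) ⊖ shift 0 0 1 0 (mono 1 0 0 0))
    ≈⟨ ⊕-cong (≈ₛ-refl {mono 0 0 1 0}) (⊖-cong (shift-mono 0 0 1 0 1 1 0 0) (shift-mono 0 0 1 0 1 0 0 0)) ⟩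
  mono 0 0 1 0 ⊕ (mono 1 1 1 0 ⊖ mono 1 0 1 0) ∎≈) ≈ₛ-refl
  where
  t[u-1]≈ : tS ⊛ (uS ⊖ 𝟙) ≈ₛ mono 1 1 0 0 ⊖ mono 1 0 0 0
  t[u-1]≈ = begin≈
    tS ⊛ (uS ⊖ 𝟙)                             ≈⟨ mono-⊛ 1 0 0 0 (uS ⊖ 𝟙) ⟩
    shift 1 0 0 0 (uS ⊖ 𝟙)                    ≈⟨ shift-⊖ 1 0 0 0 uS 𝟙 ⟩
    shift 1 0 0 0 uS ⊖ shift 1 0 0 0 𝟙        ≈⟨ ⊖-cong (shift-mono 1 0 0 0 0 1 0 0) (shift-mono 1 0 0 0 0 0 0 0) ⟩
    mono 1 1 0 0 ⊖ mono 1 0 0 0               ∎≈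

LHS-expanded RHS-expanded : ℕ → Series
LHS-expanded p = shift 0 0 1 0 (H p) ⊕ (shift 1 1 1 0 (H p) ⊖ shift 1 0 1 0 (H p)) ⊖ H p
RHS-expanded p = (mono 1 0 1 1 ⊖ mono 1 0 0 1)
                 ⊕ (shift 1 0 1 1 (H-v1 p) ⊖ shift 1 0 0 1 (H-v1 p) ⊖ shift 1 0 1 0 (H-v1 p))
                 ⊕ shift 1 1 (p + 1) 0 (H-uv1 p)

LHS-expansion : ∀ p → (vS ⊛ δ₁ ⊖ 𝟙) ⊛ H p ≈ₛ LHS-expanded p
LHS-expansion p = begin≈
  (vS ⊛ δ₁ ⊖ 𝟙) ⊛ H p
    ≈⟨ ⊛-congˡ (H p) vδ₁⊖𝟙-expansion ⟩
  (mono 0 0 1 0 ⊕ (mono 1 1 1 0 ⊖ mono 1 0 1 0) ⊖ 𝟙) ⊛ H p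
    ≈⟨ ⊛-distribʳ-⊖ (mono 0 0 1 0 ⊕ (mono 1 1 1 0 ⊖ mono 1 0 1 0)) 𝟙 (H p) ⟩
  (mono 0 0 1 0 ⊕ (mono 1 1 1 0 ⊖ mono 1 0 1 0)) ⊛ H p ⊖ 𝟙 ⊛ H p
    ≈⟨ ⊖-cong (⊛-distribʳ-⊕ (mono 0 0 1 0) (mono 1 1 1 0 ⊖ mono 1 0 1 0) (H p)) (mono-⊛ 0 0 0 0 (H p)) ⟩
  mono 0 0 1 0 ⊛ H p ⊕ (mono 1 1 1 0 ⊖ mono 1 0 1 0) ⊛ H p ⊖ H p
    ≈⟨ ⊖-cong (⊕-cong (mono-⊛ 0 0 1 0 (H p)) (⊛-distribʳ-⊖ (mono 1 1 1 0) (mono 1 0 1 0) (H p))) (≈ₛ-refl {H p}) ⟩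
  shift 0 0 1 0 (H p) ⊕ (mono 1 1 1 0 ⊛ H p ⊖ mono 1 0 1 0 ⊛ H p) ⊖ H p
    ≈⟨ ⊖-cong (⊕-cong (≈ₛ-refl {shift 0 0 1 0 (H p)}) (⊖-cong (mono-⊛ 1 1 1 0 (H p)) (mono-⊛ 1 0 1 0 (H p)))) (≈ₛ-refl {H p}) ⟩
  shift 0 0 1 0 (H p) ⊕ (shift 1 1 1 0 (H p) ⊖ shift 1 0 1 0 (H p)) ⊖ H p ∎≈

RHS-expansion : ∀ p →
  (vS ⊖ 𝟙) ⊛ tS ⊛ zS ⊕ tS ⊛ (zS ⊛ (vS ⊖ 𝟙) ⊖ vS) ⊛ H-v1 p ⊕ tS ⊛ uS ⊛ vPow (p + 1) ⊛ H-uv1 p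
    ≈ₛ RHS-expanded p
RHS-expansion p = ⊕-cong (⊕-cong boundary middle) top
  where
  boundary : (vS ⊖ 𝟙) ⊛ tS ⊛ zS ≈ₛ mono 1 0 1 1 ⊖ mono 1 0 0 1
  boundary = begin≈
    (vS ⊖ 𝟙) ⊛ tS ⊛ zS
      ≈⟨ ⊛-congˡ zS (⊛-distribʳ-⊖ vS 𝟙 tS) ⟩
    (vS ⊛ tS ⊖ 𝟙 ⊛ tS) ⊛ zS
      ≈⟨ ⊛-congˡ zS (⊖-cong (mono-⊛-mono 0 0 1 0 1 0 0 0) (mono-⊛-mono 0 0 0 0 1 0 0 0)) ⟩
    (mono 1 0 1 0 ⊖ mono 1 0 0 0) ⊛ zS
      ≈⟨ ⊛-distribʳ-⊖ (mono 1 0 1 0) (mono 1 0 0 0) zS ⟩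
    mono 1 0 1 0 ⊛ zS ⊖ mono 1 0 0 0 ⊛ zS
      ≈⟨ ⊖-cong (mono-⊛-mono 1 0 1 0 0 0 0 1) (mono-⊛-mono 1 0 0 0 0 0 0 1) ⟩
    mono 1 0 1 1 ⊖ mono 1 0 0 1 ∎≈
  t[z[v-1]-v]≈ : tS ⊛ (zS ⊛ (vS ⊖ 𝟙) ⊖ vS) ≈ₛ mono 1 0 1 1 ⊖ mono 1 0 0 1 ⊖ mono 1 0 1 0
  t[z[v-1]-v]≈ = begin≈
    tS ⊛ (zS ⊛ (vS ⊖ 𝟙) ⊖ vS)
      ≈⟨ mono-⊛ 1 0 0 0 (zS ⊛ (vS ⊖ 𝟙) ⊖ vS) ⟩
    shift 1 0 0 0 (zS ⊛ (vS ⊖ 𝟙) ⊖ vS)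
      ≈⟨ shift-cong 1 0 0 0 (⊖-cong (mono-⊛ 0 0 0 1 (vS ⊖ 𝟙)) (≈ₛ-refl {vS})) ⟩
    shift 1 0 0 0 (shift 0 0 0 1 (vS ⊖ 𝟙) ⊖ vS)
      ≈⟨ shift-cong 1 0 0 0 (⊖-cong (shift-⊖ 0 0 0 1 vS 𝟙) (≈ₛ-refl {vS})) ⟩
    shift 1 0 0 0 (shift 0 0 0 1 vS ⊖ shift 0 0 0 1 𝟙 ⊖ vS)
      ≈⟨ shift-cong 1 0 0 0 (⊖-cong (⊖-cong (shift-mono 0 0 0 1 0 0 1 0) (shift-mono 0 0 0 1 0 0 0 0)) (≈ₛ-refl {vS})) ⟩
    shift 1 0 0 0 (mono 0 0 1 1 ⊖ mono 0 0 0 1 ⊖ vS)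
      ≈⟨ shift-⊖ 1 0 0 0 (mono 0 0 1 1 ⊖ mono 0 0 0 1) vS ⟩
    shift 1 0 0 0 (mono 0 0 1 1 ⊖ mono 0 0 0 1) ⊖ shift 1 0 0 0 vS
      ≈⟨ ⊖-cong (shift-⊖ 1 0 0 0 (mono 0 0 1 1) (mono 0 0 0 1)) (shift-mono 1 0 0 0 0 0 1 0) ⟩
    shift 1 0 0 0 (mono 0 0 1 1) ⊖ shift 1 0 0 0 (mono 0 0 0 1) ⊖ mono 1 0 1 0
      ≈⟨ ⊖-cong (⊖-cong (shift-mono 1 0 0 0 0 0 1 1) (shift-mono 1 0 0 0 0 0 0 1)) ≈ₛ-refl ⟩
    mono 1 0 1 1 ⊖ mono 1 0 0 1 ⊖ mono 1 0 1 0 ∎≈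
  middle : tS ⊛ (zS ⊛ (vS ⊖ 𝟙) ⊖ vS) ⊛ H-v1 p
             ≈ₛ shift 1 0 1 1 (H-v1 p) ⊖ shift 1 0 0 1 (H-v1 p) ⊖ shift 1 0 1 0 (H-v1 p)
  middle = begin≈
    tS ⊛ (zS ⊛ (vS ⊖ 𝟙) ⊖ vS) ⊛ H-v1 p
      ≈⟨ ⊛-congˡ (H-v1 p) t[z[v-1]-v]≈ ⟩
    (mono 1 0 1 1 ⊖ mono 1 0 0 1 ⊖ mono 1 0 1 0) ⊛ H-v1 p
      ≈⟨ ⊛-distribʳ-⊖ (mono 1 0 1 1 ⊖ mono 1 0 0 1) (mono 1 0 1 0) (H-v1 p) ⟩
    (mono 1 0 1 1 ⊖ mono 1 0 0 1) ⊛ H-v1 p ⊖ mono 1 0 1 0 ⊛ H-v1 p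
      ≈⟨ ⊖-cong (⊛-distribʳ-⊖ (mono 1 0 1 1) (mono 1 0 0 1) (H-v1 p)) (mono-⊛ 1 0 1 0 (H-v1 p)) ⟩
    mono 1 0 1 1 ⊛ H-v1 p ⊖ mono 1 0 0 1 ⊛ H-v1 p ⊖ shift 1 0 1 0 (H-v1 p)
      ≈⟨ ⊖-cong (⊖-cong (mono-⊛ 1 0 1 1 (H-v1 p)) (mono-⊛ 1 0 0 1 (H-v1 p))) ≈ₛ-refl ⟩
    shift 1 0 1 1 (H-v1 p) ⊖ shift 1 0 0 1 (H-v1 p) ⊖ shift 1 0 1 0 (H-v1 p) ∎≈
  top : tS ⊛ uS ⊛ vPow (p + 1) ⊛ H-uv1 p ≈ₛ shift 1 1 (p + 1) 0 (H-uv1 p)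
  top = begin≈
    tS ⊛ uS ⊛ vPow (p + 1) ⊛ H-uv1 p
      ≈⟨ ⊛-congˡ (H-uv1 p) (⊛-congˡ (vPow (p + 1)) (mono-⊛-mono 1 0 0 0 0 1 0 0)) ⟩
    mono 1 1 0 0 ⊛ vPow (p + 1) ⊛ H-uv1 p
      ≈⟨ ⊛-congˡ (H-uv1 p) (mono-⊛-mono 1 1 0 0 0 0 (p + 1) 0) ⟩
    mono 1 1 (p + 1) 0 ⊛ H-uv1 p
      ≈⟨ mono-⊛ 1 1 (p + 1) 0 (H-uv1 p) ⟩
    shift 1 1 (p + 1) 0 (H-uv1 p) ∎≈

when-sumPAscent : ∀ c p n f → when c (ℤ.+ sumPAscent p n f) ≡ ℤ.+ sumPAscent p n (λ w → ⟦ c ⟧ * f w)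
when-sumPAscent true  p n f = cong ℤ.+_ (sumPAscent-cong p n (λ w _ _ → sym (+-identityʳ (f w))))
when-sumPAscent false p n f = cong ℤ.+_ (sym (sumPAscent-zero p n (λ _ → 0) (λ _ → refl)))

shift-genSeries : ∀ p i j k l (e₁ e₂ e₃ : List ℕ → ℕ) n a b c →
  shift i j k l (genSeries p (λ w → e₁ w , e₂ w , e₃ w)) (i + n) a b c
    ≡ ℤ.+ sumPAscent p n (λ w → δ³ (j + e₁ w) (k + e₂ w) (l + e₃ w) a b c)
shift-genSeries p i j k l e₁ e₂ e₃ n a b c rewrite ≤⇒≤ᵇ≡true (m≤m+n i n) | m+n∸m≡n i n = begin
  when G (genSeries p (λ w → e₁ w , e₂ w , e₃ w) n (a ∸ j) (b ∸ k) (c ∸ l))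
    ≡⟨ cong (when G) (genSeries≡sumPAscent p n e₁ e₂ e₃ (a ∸ j) (b ∸ k) (c ∸ l)) ⟩
  when G (ℤ.+ sumPAscent p n (λ w → δ³ (e₁ w) (e₂ w) (e₃ w) (a ∸ j) (b ∸ k) (c ∸ l)))
    ≡⟨ when-sumPAscent G p n _ ⟩
  ℤ.+ sumPAscent p n (λ w → ⟦ G ⟧ * δ³ (e₁ w) (e₂ w) (e₃ w) (a ∸ j) (b ∸ k) (c ∸ l))
    ≡⟨ cong ℤ.+_ (sumPAscent-cong p n (λ w _ _ → ⟦≤ᵇ³⟧*δ³ j k l (e₁ w) (e₂ w) (e₃ w) a b c)) ⟩
  ℤ.+ sumPAscent p n (λ w → δ³ (j + e₁ w) (k + e₂ w) (l + e₃ w) a b c) ∎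
  where
  G : Bool
  G = (j ≤ᵇ a) ∧ (k ≤ᵇ b) ∧ (l ≤ᵇ c)

transfer-to-ℤ : ∀ {t₁ t₂ t₃ t₄ b₁ b₂ b₃ b₄} → t₁ + t₂ + b₂ + b₃ ≡ b₁ + b₄ + t₃ + t₄ →
    ℤ.+ t₁ +ℤ (ℤ.+ t₂ +ℤ - ℤ.+ t₃) +ℤ - ℤ.+ t₄
  ≡ ℤ.+ 0 +ℤ (ℤ.+ b₁ +ℤ - ℤ.+ b₂ +ℤ - ℤ.+ b₃) +ℤ ℤ.+ b₄
transfer-to-ℤ {t₁} {t₂} {t₃} {t₄} {b₁} {b₂} {b₃} {b₄} eq = ∙-cancelʳ S _ _ (begin
  ℤ.+ t₁ +ℤ (ℤ.+ t₂ +ℤ - ℤ.+ t₃) +ℤ - ℤ.+ t₄ +ℤ S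
    ≡⟨ add-back (ℤ.+ t₁) (ℤ.+ t₂) (ℤ.+ t₃) (ℤ.+ t₄) (ℤ.+ b₂) (ℤ.+ b₃) ⟩
  ℤ.+ t₁ +ℤ ℤ.+ t₂ +ℤ ℤ.+ b₂ +ℤ ℤ.+ b₃
    ≡⟨ embed t₁ t₂ b₂ b₃ ⟨
  ℤ.+ (t₁ + t₂ + b₂ + b₃)
    ≡⟨ cong ℤ.+_ eq ⟩
  ℤ.+ (b₁ + b₄ + t₃ + t₄)
    ≡⟨ embed b₁ b₄ t₃ t₄ ⟩
  ℤ.+ b₁ +ℤ ℤ.+ b₄ +ℤ ℤ.+ t₃ +ℤ ℤ.+ t₄
    ≡⟨ add-back′ (ℤ.+ b₁) (ℤ.+ b₂) (ℤ.+ b₃) (ℤ.+ b₄) (ℤ.+ t₃) (ℤ.+ t₄) ⟨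
  ℤ.+ 0 +ℤ (ℤ.+ b₁ +ℤ - ℤ.+ b₂ +ℤ - ℤ.+ b₃) +ℤ ℤ.+ b₄ +ℤ S ∎)
  where
  S : ℤ
  S = ℤ.+ t₃ +ℤ ℤ.+ t₄ +ℤ ℤ.+ b₂ +ℤ ℤ.+ b₃
  embed : ∀ w x y z → ℤ.+ (w + x + y + z) ≡ ℤ.+ w +ℤ ℤ.+ x +ℤ ℤ.+ y +ℤ ℤ.+ z
  embed w x y z = trans (ℤP.pos-+ (w + x + y) z)
    (cong (_+ℤ ℤ.+ z) (trans (ℤP.pos-+ (w + x) y) (cong (_+ℤ ℤ.+ y) (ℤP.pos-+ w x))))
  add-back : ∀ T₁ T₂ T₃ T₄ B₂ B₃ →
    T₁ +ℤ (T₂ +ℤ - T₃) +ℤ - T₄ +ℤ (T₃ +ℤ T₄ +ℤ B₂ +ℤ B₃) ≡ T₁ +ℤ T₂ +ℤ B₂ +ℤ B₃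
  add-back = ℤ-Solver.solve-∀
  add-back′ : ∀ B₁ B₂ B₃ B₄ T₃ T₄ →
    ℤ.+ 0 +ℤ (B₁ +ℤ - B₂ +ℤ - B₃) +ℤ B₄ +ℤ (T₃ +ℤ T₄ +ℤ B₂ +ℤ B₃) ≡ B₁ +ℤ B₄ +ℤ T₃ +ℤ T₄
  add-back′ = ℤ-Solver.solve-∀

vH-by-last-letter : ∀ p m a b c →
  shift 0 0 1 0 (H p) (suc (suc m)) a b c
    ≡ ℤ.+ sumPAscent p (suc m) (λ w → (v· childrenCoeff (uzCoeff a c) (p + asc w) (asc w) (lastL w) (zeros w)) b)
vH-by-last-letter p m a zero    c = cong ℤ.+_ (sym (sumPAscent-zero p (suc m) (λ _ → 0) (λ _ → refl)))
vH-by-last-letter p m a (suc b) c = H-by-last-letter p m a b c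

module _ (p m a b c : ℕ) where

  private
    Σ : (List ℕ → ℕ) → ℕ
    Σ = sumPAscent p (suc m)
    T₁ T₂ T₃ T₄ B₁ B₂ B₃ B₄ : List ℕ → ℕ
    T₁ w = (v· childrenCoeff (uzCoeff a c) (p + asc w) (asc w) (lastL w) (zeros w)) b
    T₂ w = δ³ (suc (asc w)) (suc (lastL w)) (zeros w) a b c
    T₃ w = δ³ (asc w) (suc (lastL w)) (zeros w) a b c
    T₄ w = childrenCoeff (uzCoeff a c) (p + asc w) (asc w) (lastL w) (zeros w) b
    B₁ w = δ³ (asc w) 1 (suc (zeros w)) a b c
    B₂ w = δ³ (asc w) 0 (suc (zeros w)) a b c
    B₃ w = δ³ (asc w) 1 (zeros w) a b c
    B₄ w = δ³ (suc (asc w)) (suc (p + asc w)) (zeros w) a b c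

  LHS-coeff-from-2 : LHS-expanded p (suc (suc m)) a b c ≡ ℤ.+ Σ T₁ +ℤ (ℤ.+ Σ T₂ +ℤ - ℤ.+ Σ T₃) +ℤ - ℤ.+ Σ T₄
  LHS-coeff-from-2 =
    cong₂ _+ℤ_ (cong₂ _+ℤ_ (vH-by-last-letter p m a b c)
                           (cong₂ _+ℤ_ (shift-genSeries p 1 1 1 0 asc lastL zeros (suc m) a b c)
                                       (cong -_ (shift-genSeries p 1 0 1 0 asc lastL zeros (suc m) a b c))))
               (cong -_ (H-by-last-letter p m a b c))

  RHS-coeff-from-2 : RHS-expanded p (suc (suc m)) a b c ≡ ℤ.+ 0 +ℤ (ℤ.+ Σ B₁ +ℤ - ℤ.+ Σ B₂ +ℤ - ℤ.+ Σ B₃) +ℤ ℤ.+ Σ B₄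
  RHS-coeff-from-2 =
    cong₂ _+ℤ_ (cong (ℤ.+ 0 +ℤ_) (cong₂ _+ℤ_ (cong₂ _+ℤ_ (shift-genSeries p 1 0 1 1 asc (λ _ → 0) zeros (suc m) a b c)
                                                         (cong -_ (shift-genSeries p 1 0 0 1 asc (λ _ → 0) zeros (suc m) a b c)))
                                             (cong -_ (shift-genSeries p 1 0 1 0 asc (λ _ → 0) zeros (suc m) a b c))))
               (trans (shift-genSeries p 1 1 (p + 1) 0 asc asc zeros (suc m) a b c)
                      (cong ℤ.+_ (sumPAscent-cong p (suc m) (λ w _ _ → cong (λ e → δ³ (suc (asc w)) e (zeros w) a b c)
                                                                         (trans (+-assoc p 1 (asc w)) (+-suc p (asc w)))))))

  children-recurrence-summed : Σ T₁ + Σ T₂ + Σ B₂ + Σ B₃ ≡ Σ B₁ + Σ B₄ + Σ T₃ + Σ T₄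
  children-recurrence-summed = begin
    Σ T₁ + Σ T₂ + Σ B₂ + Σ B₃               ≡⟨ sumPAscent-+⁴ p (suc m) T₁ T₂ B₂ B₃ ⟨
    Σ (λ w → T₁ w + T₂ w + B₂ w + B₃ w)      ≡⟨ sumPAscent-cong p (suc m) recurrence ⟩
    Σ (λ w → B₁ w + B₄ w + T₃ w + T₄ w)      ≡⟨ sumPAscent-+⁴ p (suc m) B₁ B₄ T₃ T₄ ⟩
    Σ B₁ + Σ B₄ + Σ T₃ + Σ T₄               ∎
    where
    recurrence : ∀ w → isPAscent p w ≡ true → length w ≡ suc m → T₁ w + T₂ w + B₂ w + B₃ w ≡ B₁ w + B₄ w + T₃ w + T₄ w
    recurrence (x ∷ xs) pa _ = children-recurrence (uzCoeff a c) (asc w) (zeros w) (p + asc w) (lastL w)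
                                 (All-lastL x xs (pAscent-letters-bounded p w pa)) b
      where
      w : List ℕ
      w = x ∷ xs

  coefficients-agree-from-2 : LHS-expanded p (suc (suc m)) a b c ≡ RHS-expanded p (suc (suc m)) a b c
  coefficients-agree-from-2 =
    trans LHS-coeff-from-2 (trans signs-rearranged (sym RHS-coeff-from-2))
    where
    signs-rearranged : ℤ.+ Σ T₁ +ℤ (ℤ.+ Σ T₂ +ℤ - ℤ.+ Σ T₃) +ℤ - ℤ.+ Σ T₄
                     ≡ ℤ.+ 0 +ℤ (ℤ.+ Σ B₁ +ℤ - ℤ.+ Σ B₂ +ℤ - ℤ.+ Σ B₃) +ℤ ℤ.+ Σ B₄
    signs-rearranged = transfer-to-ℤ {Σ T₁} {Σ T₂} {Σ T₃} {Σ T₄} {Σ B₁} {Σ B₂} {Σ B₃} {Σ B₄} children-recurrence-summed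

coefficients-agree-at-1 : ∀ p a b c → LHS-expanded p 1 a b c ≡ RHS-expanded p 1 a b c
coefficients-agree-at-1 p a b c = begin
  LHS-expanded p 1 a b c
    ≡⟨ cong₂ _+ℤ_ (cong₂ _+ℤ_ (trans (shift-genSeries p 0 0 1 0 asc lastL zeros 1 a b c) (cong ℤ.+_ (sumPAscent-singleton p _)))
                              (cong₂ _+ℤ_ (shift-genSeries p 1 1 1 0 asc lastL zeros 0 a b c)
                                          (cong -_ (shift-genSeries p 1 0 1 0 asc lastL zeros 0 a b c))))
                  (cong -_ (trans (genSeries≡sumPAscent p 1 asc lastL zeros a b c) (cong ℤ.+_ (sumPAscent-singleton p _)))) ⟩
  ℤ.+ δ³ 0 1 1 a b c +ℤ ℤ.+ 0 +ℤ - ℤ.+ δ³ 0 0 1 a b c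
    ≡⟨ regroup (ℤ.+ δ³ 0 1 1 a b c) (ℤ.+ δ³ 0 0 1 a b c) ⟩
  ℤ.+ δ³ 0 1 1 a b c +ℤ - ℤ.+ δ³ 0 0 1 a b c +ℤ ℤ.+ 0 +ℤ ℤ.+ 0
    ≡⟨ cong₂ _+ℤ_ (cong₂ _+ℤ_ (cong₂ _+ℤ_ (trans (when-1 _) (cong ℤ.+_ (⟦≡ᵇ³⟧≡δ³ 0 1 1 a b c)))
                                           (cong -_ (trans (when-1 _) (cong ℤ.+_ (⟦≡ᵇ³⟧≡δ³ 0 0 1 a b c)))))
                              (cong₂ _+ℤ_ (cong₂ _+ℤ_ (shift-genSeries p 1 0 1 1 asc (λ _ → 0) zeros 0 a b c)
                                                      (cong -_ (shift-genSeries p 1 0 0 1 asc (λ _ → 0) zeros 0 a b c)))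
                                          (cong -_ (shift-genSeries p 1 0 1 0 asc (λ _ → 0) zeros 0 a b c))))
                  (shift-genSeries p 1 1 (p + 1) 0 asc asc zeros 0 a b c) ⟨
  RHS-expanded p 1 a b c ∎
  where
  regroup : ∀ X Y → X +ℤ ℤ.+ 0 +ℤ - Y ≡ X +ℤ - Y +ℤ ℤ.+ 0 +ℤ ℤ.+ 0
  regroup = ℤ-Solver.solve-∀

coefficients-agree : ∀ p → LHS-expanded p ≈ₛ RHS-expanded p
coefficients-agree p zero          a zero    c = refl
coefficients-agree p zero          a (suc b) c = refl
coefficients-agree p (suc zero)    a b       c = coefficients-agree-at-1 p a b c
coefficients-agree p (suc (suc m)) a b       c = coefficients-agree-from-2 p m a b c

lemma3p1 : (p : ℕ) → p ≥ 1 →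
    (vS ⊛ δ₁ ⊖ 𝟙) ⊛ H p
      ≈ₛ ((vS ⊖ 𝟙) ⊛ tS ⊛ zS
          ⊕ tS ⊛ (zS ⊛ (vS ⊖ 𝟙) ⊖ vS) ⊛ H-v1 p
          ⊕ tS ⊛ uS ⊛ vPow (p + 1) ⊛ H-uv1 p)
lemma3p1 p _ = begin≈
  (vS ⊛ δ₁ ⊖ 𝟙) ⊛ H p    ≈⟨ LHS-expansion p ⟩
  LHS-expanded p         ≈⟨ coefficients-agree p ⟩
  RHS-expanded p         ≈⟨ RHS-expansion p ⟨
  (vS ⊖ 𝟙) ⊛ tS ⊛ zS ⊕ tS ⊛ (zS ⊛ (vS ⊖ 𝟙) ⊖ vS) ⊛ H-v1 p ⊕ tS ⊛ uS ⊛ vPow (p + 1) ⊛ H-uv1 p ∎≈
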